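{- Let $D$ be the derivation on $\mathbb{Z}[w,x,y,z]$ determined by $D(w)=wy$, $D(x)=yz$, $D(y)=xz$, $D(z)=xy$. Then for every $n\ge0$, $$D^n(w)=w\sum_{T\in\mathcal{T}_n}x^{\mathsf{ee}^*(T)}y^{\mathsf{oe}^*(T)}z^{\mathsf{odd}^*(T)}.$$
   Context: A derivation $D$ is additive and satisfies $D(uv)=D(u)v+uD(v)$. $\mathcal{T}_n$ is the set of increasing trees on $\{1,\dots,n\}$: plane trees (rooted trees with linearly ordered children) with $n+1$ nodes labeled bijectively by $0,1,\dots,n$ such that labels increase along every root-to-leaf path and the labels of the children of each node increase from left to right. The degree of a node is its number of children; its level is its distance from the root (root at level $0$). $\mathsf{odd}^*(T)$ is the number of odd-degree nodes other than the root; $\mathsf{oe}^*(T)$ (resp. $\mathsf{ee}^*(T)$) is the number of even-degree nodes other than the root on odd (resp. even) levels. -}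

module Defs where

open import Data.Nat as ℕ using (ℕ; zero; suc; _∸_)
open import Data.Integer as ℤ using (ℤ; +_)
open import Data.Bool using (Bool; true; false; _∧_; _∨_; not; if_then_else_)
open import Data.List using (List; []; _∷_; map; concatMap; upTo; filter; foldr; length)
open import Data.Product using (_×_; _,_)
open import Function using (_∘_)
open import Relation.Binary.PropositionalEquality using (_≡_)
open import Relation.Nullary.Decidable using (⌊_⌋)

-- Polynomials are written as expressions; two expressions denote the
-- same polynomial iff they have the same coefficient at every monomial.
-- The coefficient function is defined compositionally (products via
-- the Cauchy convolution), so this is exactly equality in ℤ[w,x,y,z].

data Var : Set where
  w x y z : Var

data Poly : Set where
  con  : ℤ → Poly
  var  : Var → Poly
  _⊕_  : Poly → Poly → Poly
  _⊗_  : Poly → Poly → Poly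

infixl 6 _⊕_
infixl 7 _⊗_

-- monomial w^a x^b y^c z^d  ↦  (a , b , c , d)
Mono : Set
Mono = ℕ × ℕ × ℕ × ℕ

allB : {A : Set} → (A → Bool) → List A → Bool
allB p [] = true
allB p (a ∷ as) = p a ∧ allB p as

anyB : {A : Set} → (A → Bool) → List A → Bool
anyB p [] = false
anyB p (a ∷ as) = p a ∨ anyB p as

private
  isZeroℕ : ℕ → Bool
  isZeroℕ zero = true
  isZeroℕ (suc _) = false

  isOneℕ : ℕ → Bool
  isOneℕ (suc zero) = true
  isOneℕ _ = false

  sumℤ : List ℤ → ℤ
  sumℤ = foldr ℤ._+_ (+ 0)

  range : ℕ → List ℕ
  range n = upTo (suc n)

divisors : Mono → List (Mono × Mono)
divisors (a , b , c , d) =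
  concatMap (λ i → concatMap (λ j → concatMap (λ k → map (λ l →
    ((i , j , k , l) , (a ∸ i , b ∸ j , c ∸ k , d ∸ l))) (range d))
    (range c)) (range b)) (range a)

unitMono : Mono → Bool
unitMono (a , b , c , d) = isZeroℕ a ∧ isZeroℕ b ∧ isZeroℕ c ∧ isZeroℕ d

varMono : Var → Mono → Bool
varMono w (a , b , c , d) = isOneℕ a  ∧ isZeroℕ b ∧ isZeroℕ c ∧ isZeroℕ d
varMono x (a , b , c , d) = isZeroℕ a ∧ isOneℕ b  ∧ isZeroℕ c ∧ isZeroℕ d
varMono y (a , b , c , d) = isZeroℕ a ∧ isZeroℕ b ∧ isOneℕ c  ∧ isZeroℕ d
varMono z (a , b , c , d) = isZeroℕ a ∧ isZeroℕ b ∧ isZeroℕ c ∧ isOneℕ d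

coeff : Poly → Mono → ℤ
coeff (con c) m = if unitMono m then c else + 0
coeff (var v) m = if varMono v m then + 1 else + 0
coeff (p ⊕ q) m = coeff p m ℤ.+ coeff q m
coeff (p ⊗ q) m = sumℤ (map (λ { (m₁ , m₂) → coeff p m₁ ℤ.* coeff q m₂ }) (divisors m))

_≈_ : Poly → Poly → Set
p ≈ q = ∀ m → coeff p m ≡ coeff q m

infix 4 _≈_

_^_ : Poly → ℕ → Poly
p ^ zero = con (+ 1)
p ^ suc k = p ⊗ (p ^ k)

Σ-list : List Poly → Poly
Σ-list = foldr _⊕_ (con (+ 0))

Dvar : Var → Poly
Dvar w = var w ⊗ var y
Dvar x = var y ⊗ var z
Dvar y = var x ⊗ var z
Dvar z = var x ⊗ var y

D : Poly → Poly
D (con _) = con (+ 0)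
D (var v) = Dvar v
D (p ⊕ q) = D p ⊕ D q
D (p ⊗ q) = D p ⊗ q ⊕ p ⊗ D q

iterate : ℕ → (Poly → Poly) → Poly → Poly
iterate zero f p = p
iterate (suc n) f p = f (iterate n f p)

data LTree : Set where
  node : ℕ → List LTree → LTree

label : LTree → ℕ
label (node l _) = l

-- Enumeration of all labelled plane trees with exactly `s` nodes and
-- labels drawn from `labs` (fuel-bounded; fuel 2s+2 is ample).
mutual
  treesF : List ℕ → ℕ → ℕ → List LTree
  treesF labs zero _ = []
  treesF labs (suc f) zero = []
  treesF labs (suc f) (suc s) =
    concatMap (λ l → map (node l) (forestsF labs f s)) labs

  forestsF : List ℕ → ℕ → ℕ → List (List LTree)
  forestsF labs zero _ = []
  forestsF labs (suc f) zero = [] ∷ []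
  forestsF labs (suc f) (suc s) =
    concatMap (λ j → concatMap (λ t → map (t ∷_) (forestsF labs f (s ∸ j)))
                                (treesF labs f (suc j)))
              (upTo (suc s))

candidates : ℕ → List LTree
candidates n = treesF (upTo (suc n)) (2 ℕ.* n ℕ.+ 4) (suc n)

mutual
  labels : LTree → List ℕ
  labels (node l ts) = l ∷ labelsF ts

  labelsF : List LTree → List ℕ
  labelsF [] = []
  labelsF (t ∷ ts) = labels t ++' labelsF ts
    where
    _++'_ : List ℕ → List ℕ → List ℕ
    [] ++' ys = ys
    (a ∷ as) ++' ys = a ∷ (as ++' ys)

private
  _<ᵇ_ : ℕ → ℕ → Bool
  m <ᵇ n = ⌊ m ℕ.<? n ⌋

  _==_ : ℕ → ℕ → Bool
  m == n = ⌊ m ℕ.≟ n ⌋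

  strictlyIncreasing : List ℕ → Bool
  strictlyIncreasing [] = true
  strictlyIncreasing (a ∷ []) = true
  strictlyIncreasing (a ∷ b ∷ r) = (a <ᵇ b) ∧ strictlyIncreasing (b ∷ r)

mutual
  increasing : LTree → Bool
  increasing (node l ts) =
    allB (λ t → l <ᵇ label t) ts ∧ strictlyIncreasing (map label ts) ∧ increasingF ts

  increasingF : List LTree → Bool
  increasingF [] = true
  increasingF (t ∷ ts) = increasing t ∧ increasingF ts

-- the labelling is a bijection onto {0,…,n}: every label in {0,…,n} occurs
-- (the tree has n+1 nodes with labels in {0,…,n} by construction)
surjLabels : ℕ → LTree → Bool
surjLabels n t = allB (λ i → anyB (i ==_) (labels t)) (upTo (suc n))

-- 𝒯ₙ : the increasing trees on {1,…,n} (nodes labelled 0,…,n)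
𝒯 : ℕ → List LTree
𝒯 n = filter (λ t → T? (surjLabels n t ∧ increasing t)) (candidates n)
  where
  open import Data.Bool using (T?)

-- Statistics.  degree = number of children; level of the root = 0.

private
  even : ℕ → Bool
  even zero = true
  even (suc n) = not (even n)

mutual
  countNR : (ℕ → ℕ → Bool) → ℕ → List LTree → ℕ
  countNR P lev [] = 0
  countNR P lev (node _ cs ∷ ts) =
    (if P (length cs) lev then 1 else 0)
      ℕ.+ countNR P (suc lev) cs ℕ.+ countNR P lev ts

nonRootCount : (ℕ → ℕ → Bool) → LTree → ℕ
nonRootCount P (node _ cs) = countNR P 1 cs

odd* : LTree → ℕ
odd* = nonRootCount (λ deg lev → not (even deg))

oe* : LTree → ℕ
oe* = nonRootCount (λ deg lev → even deg ∧ not (even lev))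

ee* : LTree → ℕ
ee* = nonRootCount (λ deg lev → even deg ∧ even lev)

module Submission where

-- A polynomial is represented by a finite list of weighted monomials, and the coefficient of m
-- in D p is an explicit linear function of the coefficients of p, because D acts on a monomial
-- as Σ_v (∂m/∂v)·D v. The increasing trees on {0,…,n+1} are obtained, each exactly once, from those
-- on {0,…,n} by attaching the leaf n+1 as a new last child of some node (remove it to go back).
-- Attaching a child to a node flips the parity of its degree and creates a leaf of even degree
-- one level below: a node counted by x (even degree, even level) is turned into z and brings a
-- y-leaf, so the weight changes by x ↦ yz; likewise y ↦ xz and z ↦ xy, and attaching to the
-- uncounted root gives w ↦ wy. Summed over all nodes, the weights of the trees grown from T
-- therefore add up to D applied to the weight w x^ee* y^oe* z^odd* of T.

open import Defs
open import Data.Nat as ℕ using (ℕ; zero; suc; _∸_; _≤_; _<_; z≤n; s≤s; _≡ᵇ_; _<ᵇ_)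
import Data.Nat
import Data.Nat.Properties as ℕP
open import Data.Integer as ℤ using (ℤ)
import Data.Integer
import Data.Integer.Properties as ℤP
open import Data.Bool using (Bool; true; false; _∧_; not; if_then_else_; T)
open import Data.Bool.Properties using (∧-conicalˡ; ∧-conicalʳ)
open import Data.List using (List; []; _∷_; map; concatMap; upTo; foldr; length; _++_; filter)
import Data.List.Properties as ListP
open import Data.List.Membership.Propositional using (_∈_)
import Data.List.Membership.Propositional.Properties as ∈P
open import Data.List.Relation.Unary.Any using (here; there)
open import Data.List.Relation.Unary.All as All using (All; []; _∷_)
import Data.List.Relation.Unary.All.Properties as AllP
open import Data.Product using (_×_; _,_; proj₁; proj₂)
open import Data.Sum using (_⊎_; inj₁; inj₂)
open import Function using (_∘_)
open import Algebra.Core using (Op₂)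
open import Algebra.Structures using (IsCommutativeSemiring)
open import Algebra.Bundles using (CommutativeMonoid)
import Algebra.Properties.CommutativeSemigroup
open import Level using (0ℓ)
open import Relation.Binary.PropositionalEquality.Algebra using (isMagma)
open import Relation.Binary.Definitions using (DecidableEquality; Tri; tri<; tri≈; tri>)
open import Relation.Binary.PropositionalEquality
open import Relation.Nullary using (¬_; Dec; yes; no; does; ⌊_⌋; contradiction)
open import Relation.Nullary.Decidable using (dec-true; dec-false; _×-dec_)
open import Relation.Unary using (Pred; Decidable)

∧-true : ∀ {a b} → (a ∧ b) ≡ true → a ≡ true × b ≡ true
∧-true {a} {b} e = ∧-conicalˡ a b e , ∧-conicalʳ a b e

∧-intro : ∀ {a b} → a ≡ true → b ≡ true → (a ∧ b) ≡ true
∧-intro refl refl = refl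

≡ᵇ-refl : ∀ n → (n ≡ᵇ n) ≡ true
≡ᵇ-refl zero = refl
≡ᵇ-refl (suc n) = ≡ᵇ-refl n

≡ᵇ-sound : ∀ m n → (m ≡ᵇ n) ≡ true → m ≡ n
≡ᵇ-sound m n e = ℕP.≡ᵇ⇒≡ m n (subst T (sym e) _)

≡ᵇ-false : ∀ m n → m ≢ n → (m ≡ᵇ n) ≡ false
≡ᵇ-false m n m≢n with m ≡ᵇ n in e
... | true = contradiction (≡ᵇ-sound m n e) m≢n
... | false = refl

≡ᵇ-sym : ∀ m n → (m ≡ᵇ n) ≡ (n ≡ᵇ m)
≡ᵇ-sym zero zero = refl
≡ᵇ-sym zero (suc n) = refl
≡ᵇ-sym (suc m) zero = refl
≡ᵇ-sym (suc m) (suc n) = ≡ᵇ-sym m n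

<ᵇ-true : ∀ {m n} → m < n → (m <ᵇ n) ≡ true
<ᵇ-true {m} {n} m<n with m <ᵇ n | ℕP.<⇒<ᵇ m<n
... | true | _ = refl

<ᵇ-sound : ∀ m n → (m <ᵇ n) ≡ true → m < n
<ᵇ-sound m n e = ℕP.<ᵇ⇒< m n (subst T (sym e) _)

<ᵇ-false : ∀ {m n} → ¬ m < n → (m <ᵇ n) ≡ false
<ᵇ-false {m} {n} m≮n with m <ᵇ n in e
... | true = contradiction (<ᵇ-sound m n e) m≮n
... | false = refl

module Reflection where
  open import Data.List.Relation.Unary.Any using (Any)

  ⌊⌋-sound : ∀ {P : Set} (d : Dec P) → ⌊ d ⌋ ≡ true → P
  ⌊⌋-sound (yes p) _ = p

  ⌊⌋-complete : ∀ {P : Set} (d : Dec P) → P → ⌊ d ⌋ ≡ true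
  ⌊⌋-complete (yes _) _ = refl
  ⌊⌋-complete (no ¬p) p = contradiction p ¬p

  allB⇒All : ∀ {A : Set} {P : A → Set} (p : A → Bool) → (∀ u → p u ≡ true → P u) →
             ∀ xs → allB p xs ≡ true → All P xs
  allB⇒All p sound [] _ = []
  allB⇒All p sound (u ∷ xs) e = sound u (∧-conicalˡ _ _ e) ∷ allB⇒All p sound xs (∧-conicalʳ (p u) _ e)

  All⇒allB : ∀ {A : Set} {P : A → Set} (p : A → Bool) → (∀ u → P u → p u ≡ true) →
             ∀ {xs} → All P xs → allB p xs ≡ true
  All⇒allB p complete [] = refl
  All⇒allB p complete (Pu ∷ Pxs) = ∧-intro (complete _ Pu) (All⇒allB p complete Pxs)

  anyB⇒Any : ∀ {A : Set} {P : A → Set} (P? : ∀ u → Dec (P u)) xs →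
             anyB (λ u → ⌊ P? u ⌋) xs ≡ true → Any P xs
  anyB⇒Any P? (u ∷ xs) e with P? u
  ... | yes Pu = here Pu
  ... | no _ = there (anyB⇒Any P? xs e)

  Any⇒anyB : ∀ {A : Set} {P : A → Set} (P? : ∀ u → Dec (P u)) {xs} →
             Any P xs → anyB (λ u → ⌊ P? u ⌋) xs ≡ true
  Any⇒anyB P? {u ∷ _} (here Pu) rewrite ⌊⌋-complete (P? u) Pu = refl
  Any⇒anyB P? {u ∷ _} (there Pxs) with P? u
  ... | yes _ = refl
  ... | no _ = Any⇒anyB P? Pxs

module FiniteSums {A : Set} {plus times : Op₂ A} {0# 1# : A}
                  (isCS : IsCommutativeSemiring _≡_ plus times 0# 1#) where
  private
    infixl 6 _+_
    infixl 7 _*_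

    _+_ _*_ : Op₂ A
    _+_ = plus
    _*_ = times

  open IsCommutativeSemiring isCS
    using (+-assoc; +-comm; +-identityˡ; +-identityʳ; *-identityˡ; zeroˡ; zeroʳ; distribˡ; distribʳ)
  open ≡-Reasoning

  sum : List A → A
  sum = foldr _+_ 0#

  ind : Bool → A
  ind b = if b then 1# else 0#

  ind-∧ : ∀ a b → ind (a ∧ b) ≡ ind a * ind b
  ind-∧ true b = sym (*-identityˡ (ind b))
  ind-∧ false b = sym (zeroˡ (ind b))

  sum-++ : ∀ (us vs : List A) → sum (us ++ vs) ≡ sum us + sum vs
  sum-++ [] vs = sym (+-identityˡ (sum vs))
  sum-++ (u ∷ us) vs = trans (cong (u +_) (sum-++ us vs)) (sym (+-assoc u (sum us) (sum vs)))

  module _ {B : Set} where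

    sum-map-++ : ∀ (f : B → A) us vs → sum (map f (us ++ vs)) ≡ sum (map f us) + sum (map f vs)
    sum-map-++ f us vs = trans (cong sum (ListP.map-++ f us vs)) (sum-++ (map f us) (map f vs))

    sum-map-cong∈ : ∀ {f g : B → A} us → (∀ u → u ∈ us → f u ≡ g u) → sum (map f us) ≡ sum (map g us)
    sum-map-cong∈ [] e = refl
    sum-map-cong∈ (u ∷ us) e = cong₂ _+_ (e u (here refl)) (sum-map-cong∈ us (λ v v∈ → e v (there v∈)))

    sum-map-cong : ∀ {f g : B → A} → (∀ u → f u ≡ g u) → ∀ us → sum (map f us) ≡ sum (map g us)
    sum-map-cong e us = sum-map-cong∈ us (λ u _ → e u)

    sum-map-+ : ∀ (f g : B → A) us → sum (map (λ u → f u + g u) us) ≡ sum (map f us) + sum (map g us)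
    sum-map-+ f g [] = sym (+-identityˡ 0#)
    sum-map-+ f g (u ∷ us) = begin
      (f u + g u) + sum (map (λ u → f u + g u) us)
        ≡⟨ cong ((f u + g u) +_) (sum-map-+ f g us) ⟩
      (f u + g u) + (sum (map f us) + sum (map g us))
        ≡⟨ +-assoc (f u) (g u) _ ⟩
      f u + (g u + (sum (map f us) + sum (map g us)))
        ≡⟨ cong (f u +_) (sym (+-assoc (g u) _ _)) ⟩
      f u + ((g u + sum (map f us)) + sum (map g us))
        ≡⟨ cong (λ t → f u + (t + sum (map g us))) (+-comm (g u) _) ⟩
      f u + ((sum (map f us) + g u) + sum (map g us))
        ≡⟨ cong (f u +_) (+-assoc (sum (map f us)) _ _) ⟩
      f u + (sum (map f us) + (g u + sum (map g us)))
        ≡⟨ sym (+-assoc (f u) _ _) ⟩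
      (f u + sum (map f us)) + (g u + sum (map g us)) ∎

    sum-map-*ˡ : ∀ c (f : B → A) us → sum (map (λ u → c * f u) us) ≡ c * sum (map f us)
    sum-map-*ˡ c f [] = sym (zeroʳ c)
    sum-map-*ˡ c f (u ∷ us) = trans (cong ((c * f u) +_) (sum-map-*ˡ c f us)) (sym (distribˡ c (f u) _))

    sum-map-*ʳ : ∀ c (f : B → A) us → sum (map (λ u → f u * c) us) ≡ sum (map f us) * c
    sum-map-*ʳ c f [] = sym (zeroˡ c)
    sum-map-*ʳ c f (u ∷ us) = trans (cong ((f u * c) +_) (sum-map-*ʳ c f us)) (sym (distribʳ c (f u) _))

    sum-map-0 : ∀ (us : List B) → sum (map (λ _ → 0#) us) ≡ 0#
    sum-map-0 [] = refl
    sum-map-0 (u ∷ us) = trans (+-identityˡ _) (sum-map-0 us)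

    sum-map-∘ : ∀ {C : Set} (f : C → B) (g : B → A) us → sum (map g (map f us)) ≡ sum (map (g ∘ f) us)
    sum-map-∘ f g us = cong sum (sym (ListP.map-∘ us))

    sum-concatMap : ∀ {C : Set} (f : C → List B) (g : B → A) us →
                    sum (map g (concatMap f us)) ≡ sum (map (λ u → sum (map g (f u))) us)
    sum-concatMap f g [] = refl
    sum-concatMap f g (u ∷ us) =
      trans (sum-map-++ g (f u) (concatMap f us)) (cong (sum (map g (f u)) +_) (sum-concatMap f g us))

  sum-upTo-suc : ∀ (g : ℕ → A) K → sum (map g (upTo (suc K))) ≡ sum (map g (upTo K)) + g K
  sum-upTo-suc g K = begin
    sum (map g (upTo (suc K)))           ≡⟨ cong (sum ∘ map g) (sym (ListP.upTo-∷ʳ K)) ⟩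
    sum (map g (upTo K ++ K ∷ []))       ≡⟨ sum-map-++ g (upTo K) (K ∷ []) ⟩
    sum (map g (upTo K)) + (g K + 0#)    ≡⟨ cong (sum (map g (upTo K)) +_) (+-identityʳ (g K)) ⟩
    sum (map g (upTo K)) + g K           ∎

  sum-upTo-ind-≡ᵇ : ∀ K u (g : ℕ → A) →
                    sum (map (λ i → ind (u ≡ᵇ i) * g i) (upTo K)) ≡ ind (u <ᵇ K) * g u
  sum-upTo-ind-≡ᵇ zero u g = sym (zeroˡ (g u))
  sum-upTo-ind-≡ᵇ (suc K) u g = begin
    sum (map (λ i → ind (u ≡ᵇ i) * g i) (upTo (suc K)))
      ≡⟨ sum-upTo-suc (λ i → ind (u ≡ᵇ i) * g i) K ⟩
    sum (map (λ i → ind (u ≡ᵇ i) * g i) (upTo K)) + ind (u ≡ᵇ K) * g K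
      ≡⟨ cong (_+ ind (u ≡ᵇ K) * g K) (sum-upTo-ind-≡ᵇ K u g) ⟩
    ind (u <ᵇ K) * g u + ind (u ≡ᵇ K) * g K
      ≡⟨ last (ℕP.<-cmp u K) ⟩
    ind (u <ᵇ suc K) * g u ∎
    where
    last : Tri (u < K) (u ≡ K) (K < u) → ind (u <ᵇ K) * g u + ind (u ≡ᵇ K) * g K ≡ ind (u <ᵇ suc K) * g u
    last (tri< u<K u≢K _)
      rewrite <ᵇ-true u<K | ≡ᵇ-false u K u≢K | <ᵇ-true (ℕP.m<n⇒m<1+n u<K)
      = trans (cong ((1# * g u) +_) (zeroˡ (g K))) (+-identityʳ _)
    last (tri≈ u≮u refl _)
      rewrite <ᵇ-false u≮u | ≡ᵇ-refl u | <ᵇ-true (ℕP.n<1+n u)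
      = trans (cong (_+ (1# * g u)) (zeroˡ (g u))) (+-identityˡ _)
    last (tri> u≮K u≢K _)
      rewrite <ᵇ-false u≮K | ≡ᵇ-false u K u≢K
            | <ᵇ-false (λ u<1+K → u≮K (ℕP.≤∧≢⇒< (ℕP.≤-pred u<1+K) u≢K))
      = trans (cong ((0# * g u) +_) (zeroˡ (g K))) (+-identityʳ _)

open Data.Integer using (0ℤ; 1ℤ)

module ℤΣ = FiniteSums ℤP.+-*-isCommutativeSemiring
module ℕΣ = FiniteSums ℕP.+-*-isCommutativeSemiring

module Multiplicity {A : Set} (_≟_ : DecidableEquality A) where
  private
    module ℕ+ = Algebra.Properties.CommutativeSemigroup ℕP.+-commutativeSemigroup
    module ℤ+ = Algebra.Properties.CommutativeSemigroup ℤP.+-commutativeSemigroup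
  open ℕΣ using (sum-concatMap)
    renaming (sum to sumℕ; ind to indℕ)

  mult : A → List A → ℕ
  mult a xs = sumℕ (map (λ u → indℕ (does (a ≟ u))) xs)

  mult-++ : ∀ a xs ys → mult a (xs ++ ys) ≡ mult a xs ℕ.+ mult a ys
  mult-++ a = ℕΣ.sum-map-++ (λ u → indℕ (does (a ≟ u)))

  mult-concatMap : ∀ {B : Set} a (f : B → List A) bs →
                   mult a (concatMap f bs) ≡ sumℕ (map (λ b → mult a (f b)) bs)
  mult-concatMap a f = sum-concatMap f (λ u → indℕ (does (a ≟ u)))

  mult-∈ : ∀ {a xs} → a ∈ xs → 1 ≤ mult a xs
  mult-∈ {a} (here refl) rewrite dec-true (a ≟ a) refl = s≤s z≤n
  mult-∈ {a} {u ∷ xs} (there a∈xs) =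
    ℕP.≤-trans (mult-∈ a∈xs) (ℕP.m≤n+m (mult a xs) (indℕ (does (a ≟ u))))

  mult-∈⁻ : ∀ {a} xs → 1 ≤ mult a xs → a ∈ xs
  mult-∈⁻ {a} (u ∷ xs) 1≤mult with a ≟ u
  ... | yes a≡u = here a≡u
  ... | no _ = there (mult-∈⁻ xs 1≤mult)

  mult-∉ : ∀ {a} xs → (∀ u → u ∈ xs → a ≢ u) → mult a xs ≡ 0
  mult-∉ [] _ = refl
  mult-∉ {a} (u ∷ xs) a∉ rewrite dec-false (a ≟ u) (a∉ u (here refl)) =
    mult-∉ xs (λ v v∈ → a∉ v (there v∈))

  mult-filter : ∀ {P : Pred A 0ℓ} (P? : Decidable P) a xs →
                mult a (filter P? xs) ≡ indℕ (does (P? a)) ℕ.* mult a xs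
  mult-filter P? a [] = sym (ℕP.*-zeroʳ (indℕ (does (P? a))))
  mult-filter P? a (u ∷ xs) with P? u
  ... | yes Pu with a ≟ u
  ...   | yes refl rewrite mult-filter P? a xs | dec-true (P? a) Pu = refl
  ...   | no _ = mult-filter P? a xs
  mult-filter P? a (u ∷ xs) | no ¬Pu with a ≟ u
  ...   | yes refl rewrite mult-filter P? a xs | dec-false (P? a) ¬Pu = refl
  ...   | no _ = mult-filter P? a xs

  module _ (f : A → ℤ) where
    open Data.Integer using (_+_)
    open ℤΣ using (sum; sum-map-++)

    sum-map-mult : ∀ xs ys → (∀ a → mult a xs ≡ mult a ys) → sum (map f xs) ≡ sum (map f ys)
    sum-map-mult [] [] _ = refl
    sum-map-mult [] (u ∷ ys) same with trans (same u) (cong (ℕ._+ mult u ys) (cong indℕ (dec-true (u ≟ u) refl)))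
    ... | ()
    sum-map-mult (u ∷ xs) ys same
      with ∈P.∈-∃++ (mult-∈⁻ ys (ℕP.≤-trans (mult-∈ {u} {u ∷ xs} (here refl)) (ℕP.≤-reflexive (same u))))
    ... | ys₁ , ys₂ , refl = begin
      f u + sum (map f xs)
        ≡⟨ cong (f u +_) (sum-map-mult xs (ys₁ ++ ys₂) same′) ⟩
      f u + sum (map f (ys₁ ++ ys₂))
        ≡⟨ cong (f u +_) (sum-map-++ f ys₁ ys₂) ⟩
      f u + (sum (map f ys₁) + sum (map f ys₂))
        ≡⟨ ℤ+.x∙yz≈y∙xz (f u) (sum (map f ys₁)) (sum (map f ys₂)) ⟩
      sum (map f ys₁) + (f u + sum (map f ys₂))
        ≡⟨ sym (sum-map-++ f ys₁ (u ∷ ys₂)) ⟩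
      sum (map f (ys₁ ++ u ∷ ys₂))                   ∎
      where
      open ≡-Reasoning
      same′ : ∀ a → mult a xs ≡ mult a (ys₁ ++ ys₂)
      same′ a = ℕP.+-cancelˡ-≡ (indℕ (does (a ≟ u))) _ _ (begin
        indℕ (does (a ≟ u)) ℕ.+ mult a xs
          ≡⟨ same a ⟩
        mult a (ys₁ ++ u ∷ ys₂)
          ≡⟨ mult-++ a ys₁ (u ∷ ys₂) ⟩
        mult a ys₁ ℕ.+ (indℕ (does (a ≟ u)) ℕ.+ mult a ys₂)
          ≡⟨ ℕ+.x∙yz≈y∙xz (mult a ys₁) (indℕ (does (a ≟ u))) (mult a ys₂) ⟩
        indℕ (does (a ≟ u)) ℕ.+ (mult a ys₁ ℕ.+ mult a ys₂)
          ≡⟨ cong (indℕ (does (a ≟ u)) ℕ.+_) (sym (mult-++ a ys₁ ys₂)) ⟩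
        indℕ (does (a ≟ u)) ℕ.+ mult a (ys₁ ++ ys₂)         ∎)

module Occurrences where
  open Data.Nat using (_+_; _*_)
  open ℕΣ using (sum-map-cong; sum-map-+; sum-map-0; sum-upTo-suc; sum-upTo-ind-≡ᵇ)
    renaming (sum to sumℕ; ind to indℕ)

  open Multiplicity ℕ._≟_ public
    using () renaming (mult to occ; mult-++ to occ-++; mult-∈ to occ-∈; mult-∈⁻ to occ-∈⁻)

  occ-∉ : ∀ {i xs} → occ i xs ≡ 0 → ¬ i ∈ xs
  occ-∉ occ≡0 i∈xs with occ-∈ i∈xs
  ... | 1≤occ rewrite occ≡0 with 1≤occ
  ... | ()

  Σocc≡length : ∀ K xs → All (_< K) xs → sumℕ (map (λ i → occ i xs) (upTo K)) ≡ length xs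
  Σocc≡length K [] [] = sum-map-0 (upTo K)
  Σocc≡length K (a ∷ xs) (a<K ∷ xs<K) =
    trans (sum-map-+ (λ i → indℕ (i ≡ᵇ a)) (λ i → occ i xs) (upTo K))
          (cong₂ _+_ single (Σocc≡length K xs xs<K))
    where
    single : sumℕ (map (λ i → indℕ (i ≡ᵇ a)) (upTo K)) ≡ 1
    single = begin
      sumℕ (map (λ i → indℕ (i ≡ᵇ a)) (upTo K))
        ≡⟨ sum-map-cong (λ i → trans (cong indℕ (≡ᵇ-sym i a)) (sym (ℕP.*-identityʳ _))) (upTo K) ⟩
      sumℕ (map (λ i → indℕ (a ≡ᵇ i) * 1) (upTo K))
        ≡⟨ sum-upTo-ind-≡ᵇ K a (λ _ → 1) ⟩
      indℕ (a <ᵇ K) * 1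
        ≡⟨ cong (λ b → indℕ b * 1) (<ᵇ-true a<K) ⟩
      1 ∎
      where open ≡-Reasoning

  Σ-upTo-≥ : ∀ K (g : ℕ → ℕ) → (∀ i → i < K → 1 ≤ g i) → K ≤ sumℕ (map g (upTo K))
  Σ-upTo-≥ zero g _ = z≤n
  Σ-upTo-≥ (suc K) g g≥1 rewrite sum-upTo-suc g K =
    ℕP.≤-trans (ℕP.≤-reflexive (ℕP.+-comm 1 K))
               (ℕP.+-mono-≤ (Σ-upTo-≥ K g (λ i i<K → g≥1 i (ℕP.m<n⇒m<1+n i<K))) (g≥1 K (ℕP.n<1+n K)))

  pigeonhole : ∀ K xs → length xs ≡ suc K → (∀ i → i ≤ K → i ∈ xs) → All (_≤ K) xs → occ K xs ≡ 1
  pigeonhole K xs len cover bound = ℕP.≤-antisym occ≤1 (occ-∈ (cover K ℕP.≤-refl))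
    where
    others : ℕ
    others = sumℕ (map (λ i → occ i xs) (upTo K))
    total : others + occ K xs ≡ suc K
    total = trans (sym (sum-upTo-suc (λ i → occ i xs) K))
                  (trans (Σocc≡length (suc K) xs (All.map s≤s bound)) len)
    others≥K : K ≤ others
    others≥K = Σ-upTo-≥ K (λ i → occ i xs) (λ i i<K → occ-∈ (cover i (ℕP.<⇒≤ i<K)))
    occ≤1 : occ K xs ≤ 1
    occ≤1 = ℕP.+-cancelˡ-≤ K (occ K xs) 1
              (ℕP.≤-trans (ℕP.+-monoˡ-≤ (occ K xs) others≥K) (ℕP.≤-reflexive (trans total (ℕP.+-comm 1 K))))

module Monomials where
  open ℕP using (+-assoc; +-comm; +-identityʳ; m≤m+n; m+n∸m≡n; m+n∸n≡m; m+[n∸m]≡n)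

  _==ₘ_ : Mono → Mono → Bool
  (a , b , c , d) ==ₘ (a' , b' , c' , d') = (a ≡ᵇ a') ∧ ((b ≡ᵇ b') ∧ ((c ≡ᵇ c') ∧ (d ≡ᵇ d')))

  ==ₘ-sound : ∀ m m' → (m ==ₘ m') ≡ true → m ≡ m'
  ==ₘ-sound (a , b , c , d) (a' , b' , c' , d') e
    with ∧-true {a ≡ᵇ a'} e
  ... | ea , e₂ with ∧-true {b ≡ᵇ b'} e₂
  ... | eb , e₃ with ∧-true {c ≡ᵇ c'} e₃
  ... | ec , ed
    rewrite ≡ᵇ-sound a a' ea | ≡ᵇ-sound b b' eb | ≡ᵇ-sound c c' ec | ≡ᵇ-sound d d' ed = refl

  ==ₘ-refl : ∀ m → (m ==ₘ m) ≡ true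
  ==ₘ-refl (a , b , c , d) rewrite ≡ᵇ-refl a | ≡ᵇ-refl b | ≡ᵇ-refl c | ≡ᵇ-refl d = refl

  ==ₘ-false : ∀ m m' → m ≢ m' → (m ==ₘ m') ≡ false
  ==ₘ-false m m' m≢m' with m ==ₘ m' in e
  ... | true = contradiction (==ₘ-sound m m' e) m≢m'
  ... | false = refl

  ==ₘ-false⇒≢ : ∀ {m m'} → (m ==ₘ m') ≡ false → m ≢ m'
  ==ₘ-false⇒≢ {m} e refl with trans (sym e) (==ₘ-refl m)
  ... | ()

  _+ₘ_ : Mono → Mono → Mono
  (a , b , c , d) +ₘ (a' , b' , c' , d') = (a ℕ.+ a' , b ℕ.+ b' , c ℕ.+ c' , d ℕ.+ d')

  mono≡ : ∀ {a b c d a' b' c' d'} → a ≡ a' → b ≡ b' → c ≡ c' → d ≡ d' →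
          _≡_ {A = Mono} (a , b , c , d) (a' , b' , c' , d')
  mono≡ refl refl refl refl = refl

  +ₘ-assoc : ∀ m₀ m₁ m₂ → (m₀ +ₘ m₁) +ₘ m₂ ≡ m₀ +ₘ (m₁ +ₘ m₂)
  +ₘ-assoc (a , b , c , d) (a' , b' , c' , d') (a'' , b'' , c'' , d'') =
    mono≡ (+-assoc a a' a'') (+-assoc b b' b'') (+-assoc c c' c'') (+-assoc d d' d'')

  +ₘ-comm : ∀ m₀ m₁ → m₀ +ₘ m₁ ≡ m₁ +ₘ m₀
  +ₘ-comm (a , b , c , d) (a' , b' , c' , d') =
    mono≡ (+-comm a a') (+-comm b b') (+-comm c c') (+-comm d d')

  +ₘ-identityʳ : ∀ m → m +ₘ (0 , 0 , 0 , 0) ≡ m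
  +ₘ-identityʳ (a , b , c , d) =
    mono≡ (+-identityʳ a) (+-identityʳ b) (+-identityʳ c) (+-identityʳ d)

  +ₘ-commutativeMonoid : CommutativeMonoid 0ℓ 0ℓ
  +ₘ-commutativeMonoid = record
    { isCommutativeMonoid = record
      { isMonoid = record
        { isSemigroup = record { isMagma = isMagma _+ₘ_ ; assoc = +ₘ-assoc }
        ; identity = (λ _ → refl) , +ₘ-identityʳ
        }
      ; comm = +ₘ-comm
      }
    }

  _∸ₘ_ : Mono → Mono → Mono
  (a , b , c , d) ∸ₘ (a' , b' , c' , d') = (a ∸ a' , b ∸ b' , c ∸ c' , d ∸ d')

  _≤ₘ_ : Mono → Mono → Set
  (a , b , c , d) ≤ₘ (a' , b' , c' , d') = a ≤ a' × b ≤ b' × c ≤ c' × d ≤ d'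

  -- Opaque so that `with m₀ ≤ₘ? m` finds the decision in goals.
  opaque
    _≤ₘ?_ : ∀ m₀ m → Dec (m₀ ≤ₘ m)
    (a , b , c , d) ≤ₘ? (a' , b' , c' , d') =
      a ℕ.≤? a' ×-dec b ℕ.≤? b' ×-dec c ℕ.≤? c' ×-dec d ℕ.≤? d'

  ≤ₘ-+ₘ : ∀ m₀ m → m₀ ≤ₘ (m₀ +ₘ m)
  ≤ₘ-+ₘ (a , b , c , d) (a' , b' , c' , d') =
    m≤m+n a a' , m≤m+n b b' , m≤m+n c c' , m≤m+n d d'

  +ₘ-∸ₘ : ∀ m₀ m → (m₀ +ₘ m) ∸ₘ m₀ ≡ m
  +ₘ-∸ₘ (a , b , c , d) (a' , b' , c' , d') =
    mono≡ (m+n∸m≡n a a') (m+n∸m≡n b b') (m+n∸m≡n c c') (m+n∸m≡n d d')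

  ∸ₘ-+ₘ : ∀ m₀ m → m₀ ≤ₘ m → m₀ +ₘ (m ∸ₘ m₀) ≡ m
  ∸ₘ-+ₘ (a , b , c , d) (a' , b' , c' , d') (a≤ , b≤ , c≤ , d≤) =
    mono≡ (m+[n∸m]≡n a≤) (m+[n∸m]≡n b≤) (m+[n∸m]≡n c≤) (m+[n∸m]≡n d≤)

  monoOf : Var → Mono
  monoOf w = (1 , 0 , 0 , 0)
  monoOf x = (0 , 1 , 0 , 0)
  monoOf y = (0 , 0 , 1 , 0)
  monoOf z = (0 , 0 , 0 , 1)

  exponent : Var → Mono → ℕ
  exponent w (a , b , c , d) = a
  exponent x (a , b , c , d) = b
  exponent y (a , b , c , d) = c
  exponent z (a , b , c , d) = d

  lower raise : Var → Mono → Mono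
  lower w (a , b , c , d) = (a ∸ 1 , b , c , d)
  lower x (a , b , c , d) = (a , b ∸ 1 , c , d)
  lower y (a , b , c , d) = (a , b , c ∸ 1 , d)
  lower z (a , b , c , d) = (a , b , c , d ∸ 1)
  raise w (a , b , c , d) = (suc a , b , c , d)
  raise x (a , b , c , d) = (a , suc b , c , d)
  raise y (a , b , c , d) = (a , b , suc c , d)
  raise z (a , b , c , d) = (a , b , c , suc d)

  lower-raise : ∀ v m → lower v (raise v m) ≡ m
  lower-raise w m = refl
  lower-raise x m = refl
  lower-raise y m = refl
  lower-raise z m = refl

  raise-lower : ∀ v m {e} → exponent v m ≡ suc e → raise v (lower v m) ≡ m
  raise-lower w (suc a , b , c , d) _ = refl
  raise-lower x (a , suc b , c , d) _ = refl
  raise-lower y (a , b , suc c , d) _ = refl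
  raise-lower z (a , b , c , suc d) _ = refl

  exponent-+ₘ : ∀ v m₀ m₁ → exponent v (m₀ +ₘ m₁) ≡ exponent v m₀ ℕ.+ exponent v m₁
  exponent-+ₘ w m₀ m₁ = refl
  exponent-+ₘ x m₀ m₁ = refl
  exponent-+ₘ y m₀ m₁ = refl
  exponent-+ₘ z m₀ m₁ = refl

  lower-+ₘ : ∀ v m₀ m₁ → exponent v m₀ ≡ 0 ⊎ lower v (m₀ +ₘ m₁) ≡ lower v m₀ +ₘ m₁
  lower-+ₘ w (zero , _) _ = inj₁ refl
  lower-+ₘ w (suc a , _) _ = inj₂ refl
  lower-+ₘ x (_ , zero , _) _ = inj₁ refl
  lower-+ₘ x (_ , suc b , _) _ = inj₂ refl
  lower-+ₘ y (_ , _ , zero , _) _ = inj₁ refl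
  lower-+ₘ y (_ , _ , suc c , _) _ = inj₂ refl
  lower-+ₘ z (_ , _ , _ , zero) _ = inj₁ refl
  lower-+ₘ z (_ , _ , _ , suc d) _ = inj₂ refl

  lower-+ₘ-monoOf : ∀ v R → lower v (R +ₘ monoOf v) ≡ R
  lower-+ₘ-monoOf w (a , b , c , d) = mono≡ (m+n∸n≡m a 1) (+-identityʳ b) (+-identityʳ c) (+-identityʳ d)
  lower-+ₘ-monoOf x (a , b , c , d) = mono≡ (+-identityʳ a) (m+n∸n≡m b 1) (+-identityʳ c) (+-identityʳ d)
  lower-+ₘ-monoOf y (a , b , c , d) = mono≡ (+-identityʳ a) (+-identityʳ b) (m+n∸n≡m c 1) (+-identityʳ d)
  lower-+ₘ-monoOf z (a , b , c , d) = mono≡ (+-identityʳ a) (+-identityʳ b) (+-identityʳ c) (m+n∸n≡m d 1)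

module Polynomials where
  open Monomials
  open Data.Integer using (_+_; _*_)
  open import Data.Integer.Tactic.RingSolver using (solve-∀)
  open ℤΣ
  open ≡-Reasoning

  ind-∧⁴ : ∀ p q r s → ind (p ∧ (q ∧ (r ∧ s))) ≡ ind p * (ind q * (ind r * ind s))
  ind-∧⁴ p q r s =
    trans (ind-∧ p _) (cong (ind p *_) (trans (ind-∧ q _) (cong (ind q *_) (ind-∧ r s))))

  -- Opaque, so that unification treats δ as a constant instead of unfolding it into the
  -- conjunction of four coordinate tests.
  opaque
    δ : Mono → ℤ → Mono → ℤ
    δ m₀ k m = ind (m₀ ==ₘ m) * k

    δ-diff : ∀ m₀ k m → m₀ ≢ m → δ m₀ k m ≡ 0ℤ
    δ-diff m₀ k m m₀≢m rewrite ==ₘ-false m₀ m m₀≢m = ℤP.*-zeroˡ k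

    if≡δ : ∀ m₀ k m → (if m₀ ==ₘ m then k else 0ℤ) ≡ δ m₀ k m
    if≡δ m₀ k m with m₀ ==ₘ m
    ... | true = sym (ℤP.*-identityˡ k)
    ... | false = sym (ℤP.*-zeroˡ k)

    δ-0 : ∀ m₀ m → δ m₀ 0ℤ m ≡ 0ℤ
    δ-0 m₀ m = ℤP.*-zeroʳ (ind (m₀ ==ₘ m))

    δ-+ : ∀ m₀ k k' m → δ m₀ (k + k') m ≡ δ m₀ k m + δ m₀ k' m
    δ-+ m₀ k k' m = ℤP.*-distribˡ-+ (ind (m₀ ==ₘ m)) k k'

    δ-* : ∀ m₀ c k m → δ m₀ (c * k) m ≡ c * δ m₀ k m
    δ-* m₀ c k m = *-exchange (ind (m₀ ==ₘ m)) c k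
      where
      *-exchange : ∀ a b c → a * (b * c) ≡ b * (a * c)
      *-exchange = solve-∀

    δ-factors : ∀ a₀ b₀ c₀ d₀ k a b c d → δ (a₀ , b₀ , c₀ , d₀) k (a , b , c , d)
                ≡ ind (a₀ ≡ᵇ a) * (ind (b₀ ≡ᵇ b) * (ind (c₀ ≡ᵇ c) * ind (d₀ ≡ᵇ d))) * k
    δ-factors a₀ b₀ c₀ d₀ k a b c d =
      cong (_* k) (ind-∧⁴ (a₀ ≡ᵇ a) (b₀ ≡ᵇ b) (c₀ ≡ᵇ c) (d₀ ≡ᵇ d))

    δ-⇔ : ∀ {m₀ m m₀' m'} k → (m₀ ≡ m → m₀' ≡ m') → (m₀' ≡ m' → m₀ ≡ m) →
          δ m₀ k m ≡ δ m₀' k m'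
    δ-⇔ {m₀} {m} {m₀'} {m'} k to from with m₀ ==ₘ m in e | m₀' ==ₘ m' in e'
    ... | true  | true  = refl
    ... | false | false = refl
    ... | true  | false = contradiction (to (==ₘ-sound m₀ m e)) (==ₘ-false⇒≢ e')
    ... | false | true  = contradiction (from (==ₘ-sound m₀' m' e')) (==ₘ-false⇒≢ e)

    δ-weighted : ∀ (g : Mono → ℤ) m₀ k m → g m * δ m₀ k m ≡ δ m₀ (k * g m₀) m
    δ-weighted g m₀ k m with m₀ ==ₘ m in e
    ... | true rewrite ==ₘ-sound m₀ m e = swap (g m) k
      where
      swap : ∀ a b → a * (1ℤ * b) ≡ 1ℤ * (b * a)
      swap = solve-∀
    ... | false = ℤP.*-zeroʳ (g m)

  δ-resp : ∀ {m₀ m₀'} k → k ≡ 0ℤ ⊎ m₀ ≡ m₀' → δ m₀ k ≗ δ m₀' k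
  δ-resp {m₀} {m₀'} k (inj₁ refl) m = trans (δ-0 m₀ m) (sym (δ-0 m₀' m))
  δ-resp k (inj₂ refl) m = refl

  Σ≤ : ℕ → (ℕ → ℤ) → ℤ
  Σ≤ n f = sum (map f (upTo (suc n)))

  sum-divisors : ∀ (F : Mono × Mono → ℤ) (G : ℕ → ℕ → ℕ → ℕ → ℤ) a b c d →
                 (∀ i j h l → F ((i , j , h , l) , (a ∸ i , b ∸ j , c ∸ h , d ∸ l)) ≡ G i j h l) →
                 sum (map F (divisors (a , b , c , d)))
                 ≡ Σ≤ a (λ i → Σ≤ b (λ j → Σ≤ c (λ h → Σ≤ d (λ l → G i j h l))))
  sum-divisors F G a b c d e =
    trans (sum-concatMap (layer₁) F (upTo (suc a))) (sum-map-cong (λ i →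
    trans (sum-concatMap (layer₂ i) F (upTo (suc b))) (sum-map-cong (λ j →
    trans (sum-concatMap (layer₃ i j) F (upTo (suc c))) (sum-map-cong (λ h →
    trans (sum-map-∘ (pair i j h) F (upTo (suc d))) (sum-map-cong (e i j h) (upTo (suc d))))
      (upTo (suc c)))) (upTo (suc b)))) (upTo (suc a)))
    where
    pair : ℕ → ℕ → ℕ → ℕ → Mono × Mono
    pair i j h l = ((i , j , h , l) , (a ∸ i , b ∸ j , c ∸ h , d ∸ l))
    layer₃ : ℕ → ℕ → ℕ → List (Mono × Mono)
    layer₃ i j h = map (pair i j h) (upTo (suc d))
    layer₂ : ℕ → ℕ → List (Mono × Mono)
    layer₂ i j = concatMap (layer₃ i j) (upTo (suc c))
    layer₁ : ℕ → List (Mono × Mono)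
    layer₁ i = concatMap (layer₂ i) (upTo (suc b))

  Σ≤-pull : ∀ n X (g : ℕ → ℤ) R → Σ≤ n (λ j → X * (g j * R)) ≡ X * (Σ≤ n g * R)
  Σ≤-pull n X g R = trans (sum-map-*ˡ X _ (upTo (suc n))) (cong (X *_) (sum-map-*ʳ R g (upTo (suc n))))

  Σ≤-product : ∀ a b c d (f g h e : ℕ → ℤ) K →
               Σ≤ a (λ i → Σ≤ b (λ j → Σ≤ c (λ k → Σ≤ d (λ l → f i * (g j * (h k * (e l * K)))))))
               ≡ Σ≤ a f * (Σ≤ b g * (Σ≤ c h * (Σ≤ d e * K)))
  Σ≤-product a b c d f g h e K = begin
    Σ≤ a (λ i → Σ≤ b (λ j → Σ≤ c (λ k → Σ≤ d (λ l → f i * (g j * (h k * (e l * K)))))))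
      ≡⟨ cong-Σ≤ a (λ i → cong-Σ≤ b (λ j → cong-Σ≤ c (λ k → pull₃ (f i) (g j) (h k)))) ⟩
    Σ≤ a (λ i → Σ≤ b (λ j → Σ≤ c (λ k → f i * (g j * (h k * E)))))
      ≡⟨ cong-Σ≤ a (λ i → cong-Σ≤ b (λ j → pull₂ (f i) (g j))) ⟩
    Σ≤ a (λ i → Σ≤ b (λ j → f i * (g j * (Σ≤ c h * E))))
      ≡⟨ cong-Σ≤ a (λ i → Σ≤-pull b (f i) g (Σ≤ c h * E)) ⟩
    Σ≤ a (λ i → f i * (Σ≤ b g * (Σ≤ c h * E)))
      ≡⟨ sum-map-*ʳ _ f (upTo (suc a)) ⟩
    Σ≤ a f * (Σ≤ b g * (Σ≤ c h * E)) ∎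
    where
    E = Σ≤ d e * K
    cong-Σ≤ : ∀ n {u v : ℕ → ℤ} → (∀ i → u i ≡ v i) → Σ≤ n u ≡ Σ≤ n v
    cong-Σ≤ n eq = sum-map-cong eq (upTo (suc n))
    pull₂ : ∀ X Y → Σ≤ c (λ k → X * (Y * (h k * E))) ≡ X * (Y * (Σ≤ c h * E))
    pull₂ X Y = trans (sum-map-*ˡ X _ (upTo (suc c))) (cong (X *_) (Σ≤-pull c Y h E))
    pull₃ : ∀ X Y Z → Σ≤ d (λ l → X * (Y * (Z * (e l * K)))) ≡ X * (Y * (Z * E))
    pull₃ X Y Z = trans (sum-map-*ˡ X _ (upTo (suc d))) (cong (X *_) (pull Y Z))
      where
      pull : ∀ Y Z → Σ≤ d (λ l → Y * (Z * (e l * K))) ≡ Y * (Z * E)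
      pull Y Z = trans (sum-map-*ˡ Y _ (upTo (suc d))) (cong (Y *_) (Σ≤-pull d Z e K))

  isSplit : ℕ → ℕ → ℕ → ℕ → ℤ
  isSplit x₀ x₁ n i = ind (x₀ ≡ᵇ i) * ind (x₁ ≡ᵇ n ∸ i)

  Σ≤-isSplit : ∀ x₀ x₁ n → Σ≤ n (isSplit x₀ x₁ n) ≡ ind (x₀ ℕ.+ x₁ ≡ᵇ n)
  Σ≤-isSplit x₀ x₁ n = begin
    Σ≤ n (isSplit x₀ x₁ n)                      ≡⟨ sum-upTo-ind-≡ᵇ (suc n) x₀ (λ i → ind (x₁ ≡ᵇ n ∸ i)) ⟩
    ind (x₀ <ᵇ suc n) * ind (x₁ ≡ᵇ n ∸ x₀)      ≡⟨ sym (ind-∧ (x₀ <ᵇ suc n) _) ⟩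
    ind ((x₀ <ᵇ suc n) ∧ (x₁ ≡ᵇ n ∸ x₀))         ≡⟨ cong ind (split-≡ᵇ x₀ x₁ n) ⟩
    ind (x₀ ℕ.+ x₁ ≡ᵇ n)                        ∎
    where
    split-≡ᵇ : ∀ x₀ x₁ n → ((x₀ <ᵇ suc n) ∧ (x₁ ≡ᵇ n ∸ x₀)) ≡ (x₀ ℕ.+ x₁ ≡ᵇ n)
    split-≡ᵇ zero x₁ n = refl
    split-≡ᵇ (suc x₀) x₁ zero = refl
    split-≡ᵇ (suc x₀) x₁ (suc n) = split-≡ᵇ x₀ x₁ n

  convolution : (Mono → ℤ) → (Mono → ℤ) → Mono → ℤ
  convolution f g m = sum (map (λ p → f (proj₁ p) * g (proj₂ p)) (divisors m))

  convolution-δ-δ : ∀ m₀ k₀ m₁ k₁ m →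
                    convolution (δ m₀ k₀) (δ m₁ k₁) m ≡ δ (m₀ +ₘ m₁) (k₀ * k₁) m
  convolution-δ-δ m₀@(a₀ , b₀ , c₀ , d₀) k₀ m₁@(a₁ , b₁ , c₁ , d₁) k₁ (a , b , c , d) = begin
    convolution (δ m₀ k₀) (δ m₁ k₁) (a , b , c , d)
      ≡⟨ sum-divisors (λ p → δ m₀ k₀ (proj₁ p) * δ m₁ k₁ (proj₂ p))
                      (λ i j h l → Sa i * (Sb j * (Sc h * (Sd l * K)))) a b c d factors ⟩
    Σ≤ a (λ i → Σ≤ b (λ j → Σ≤ c (λ h → Σ≤ d (λ l → Sa i * (Sb j * (Sc h * (Sd l * K)))))))
      ≡⟨ Σ≤-product a b c d Sa Sb Sc Sd K ⟩
    Σ≤ a Sa * (Σ≤ b Sb * (Σ≤ c Sc * (Σ≤ d Sd * K)))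
      ≡⟨ cong₂ _*_ (Σ≤-isSplit a₀ a₁ a) (cong₂ _*_ (Σ≤-isSplit b₀ b₁ b)
           (cong₂ _*_ (Σ≤-isSplit c₀ c₁ c) (cong (_* K) (Σ≤-isSplit d₀ d₁ d)))) ⟩
    Ia * (Ib * (Ic * (Id * K)))
      ≡⟨ *-assoc⁴ Ia Ib Ic Id K ⟩
    Ia * (Ib * (Ic * Id)) * K
      ≡⟨ sym (δ-factors (a₀ ℕ.+ a₁) (b₀ ℕ.+ b₁) (c₀ ℕ.+ c₁) (d₀ ℕ.+ d₁) K a b c d) ⟩
    δ (a₀ ℕ.+ a₁ , b₀ ℕ.+ b₁ , c₀ ℕ.+ c₁ , d₀ ℕ.+ d₁) K (a , b , c , d) ∎
    where
    K = k₀ * k₁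
    Ia = ind (a₀ ℕ.+ a₁ ≡ᵇ a)
    Ib = ind (b₀ ℕ.+ b₁ ≡ᵇ b)
    Ic = ind (c₀ ℕ.+ c₁ ≡ᵇ c)
    Id = ind (d₀ ℕ.+ d₁ ≡ᵇ d)
    Sa = isSplit a₀ a₁ a
    Sb = isSplit b₀ b₁ b
    Sc = isSplit c₀ c₁ c
    Sd = isSplit d₀ d₁ d
    *-assoc⁴ : ∀ p q r s t → p * (q * (r * (s * t))) ≡ p * (q * (r * s)) * t
    *-assoc⁴ = solve-∀
    regroup : ∀ p₀ q₀ r₀ s₀ p₁ q₁ r₁ s₁ u v →
              p₀ * (q₀ * (r₀ * s₀)) * u * (p₁ * (q₁ * (r₁ * s₁)) * v)
              ≡ p₀ * p₁ * (q₀ * q₁ * (r₀ * r₁ * (s₀ * s₁ * (u * v))))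
    regroup = solve-∀
    factors : ∀ i j h l →
              δ m₀ k₀ (i , j , h , l) * δ m₁ k₁ (a ∸ i , b ∸ j , c ∸ h , d ∸ l)
              ≡ Sa i * (Sb j * (Sc h * (Sd l * K)))
    factors i j h l =
      trans (cong₂ _*_ (δ-factors a₀ b₀ c₀ d₀ k₀ i j h l)
                       (δ-factors a₁ b₁ c₁ d₁ k₁ (a ∸ i) (b ∸ j) (c ∸ h) (d ∸ l)))
            (regroup (ind (a₀ ≡ᵇ i)) (ind (b₀ ≡ᵇ j)) (ind (c₀ ≡ᵇ h)) (ind (d₀ ≡ᵇ l))
                     (ind (a₁ ≡ᵇ a ∸ i)) (ind (b₁ ≡ᵇ b ∸ j)) (ind (c₁ ≡ᵇ c ∸ h)) (ind (d₁ ≡ᵇ d ∸ l))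
                     k₀ k₁)

  Terms : Set
  Terms = List (ℤ × Mono)

  evalTerm : Mono → ℤ × Mono → ℤ
  evalTerm m (k , m₀) = δ m₀ k m

  ⟦_⟧ : Terms → Mono → ℤ
  ⟦ A ⟧ m = sum (map (evalTerm m) A)

  ⟦⟧-++ : ∀ A B m → ⟦ A ++ B ⟧ m ≡ ⟦ A ⟧ m + ⟦ B ⟧ m
  ⟦⟧-++ A B m = sum-map-++ (evalTerm m) A B

  ⟦⟧-0∷ : ∀ m₀ A m → ⟦ (0ℤ , m₀) ∷ A ⟧ m ≡ ⟦ A ⟧ m
  ⟦⟧-0∷ m₀ A m = trans (cong (_+ ⟦ A ⟧ m) (δ-0 m₀ m)) (ℤP.+-identityˡ (⟦ A ⟧ m))

  convolution-0ˡ : ∀ (g : Mono → ℤ) m → convolution (λ _ → 0ℤ) g m ≡ 0ℤ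
  convolution-0ˡ g m = trans (sum-map-*ˡ 0ℤ (λ p → g (proj₂ p)) (divisors m))
                             (ℤP.*-zeroˡ (sum (map (λ p → g (proj₂ p)) (divisors m))))

  convolution-0ʳ : ∀ (f : Mono → ℤ) m → convolution f (λ _ → 0ℤ) m ≡ 0ℤ
  convolution-0ʳ f m = trans (sum-map-*ʳ 0ℤ (λ p → f (proj₁ p)) (divisors m))
                             (ℤP.*-zeroʳ (sum (map (λ p → f (proj₁ p)) (divisors m))))

  convolution-+ˡ : ∀ (f f' g : Mono → ℤ) m →
                   convolution (λ n → f n + f' n) g m ≡ convolution f g m + convolution f' g m
  convolution-+ˡ f f' g m =
    trans (sum-map-cong (λ p → ℤP.*-distribʳ-+ (g (proj₂ p)) (f (proj₁ p)) (f' (proj₁ p))) (divisors m))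
          (sum-map-+ (λ p → f (proj₁ p) * g (proj₂ p)) (λ p → f' (proj₁ p) * g (proj₂ p)) (divisors m))

  convolution-+ʳ : ∀ (f g g' : Mono → ℤ) m →
                   convolution f (λ n → g n + g' n) m ≡ convolution f g m + convolution f g' m
  convolution-+ʳ f g g' m =
    trans (sum-map-cong (λ p → ℤP.*-distribˡ-+ (f (proj₁ p)) (g (proj₂ p)) (g' (proj₂ p))) (divisors m))
          (sum-map-+ (λ p → f (proj₁ p) * g (proj₂ p)) (λ p → f (proj₁ p) * g' (proj₂ p)) (divisors m))

  convolution-cong : ∀ {f f' g g' : Mono → ℤ} → f ≗ f' → g ≗ g' → convolution f g ≗ convolution f' g'
  convolution-cong f≗f' g≗g' m =
    sum-map-cong (λ p → cong₂ _*_ (f≗f' (proj₁ p)) (g≗g' (proj₂ p))) (divisors m)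

  mulTerm : ℤ → Mono → Terms → Terms
  mulTerm k m₀ [] = []
  mulTerm k m₀ ((k' , m₁) ∷ B) = (k * k' , m₀ +ₘ m₁) ∷ mulTerm k m₀ B

  mulTerms : Terms → Terms → Terms
  mulTerms [] B = []
  mulTerms ((k , m₀) ∷ A) B = mulTerm k m₀ B ++ mulTerms A B

  convolution-mulTerm : ∀ k m₀ B m → convolution (δ m₀ k) ⟦ B ⟧ m ≡ ⟦ mulTerm k m₀ B ⟧ m
  convolution-mulTerm k m₀ [] m = convolution-0ʳ (δ m₀ k) m
  convolution-mulTerm k m₀ ((k' , m₁) ∷ B) m =
    trans (convolution-+ʳ (δ m₀ k) (δ m₁ k') ⟦ B ⟧ m)
          (cong₂ _+_ (convolution-δ-δ m₀ k m₁ k' m) (convolution-mulTerm k m₀ B m))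

  convolution-mulTerms : ∀ A B → convolution ⟦ A ⟧ ⟦ B ⟧ ≗ ⟦ mulTerms A B ⟧
  convolution-mulTerms [] B m = convolution-0ˡ ⟦ B ⟧ m
  convolution-mulTerms ((k , m₀) ∷ A) B m = begin
    convolution ⟦ (k , m₀) ∷ A ⟧ ⟦ B ⟧ m
      ≡⟨ convolution-+ˡ (δ m₀ k) ⟦ A ⟧ ⟦ B ⟧ m ⟩
    convolution (δ m₀ k) ⟦ B ⟧ m + convolution ⟦ A ⟧ ⟦ B ⟧ m
      ≡⟨ cong₂ _+_ (convolution-mulTerm k m₀ B m) (convolution-mulTerms A B m) ⟩
    ⟦ mulTerm k m₀ B ⟧ m + ⟦ mulTerms A B ⟧ m
      ≡⟨ sym (⟦⟧-++ (mulTerm k m₀ B) (mulTerms A B) m) ⟩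
    ⟦ mulTerms ((k , m₀) ∷ A) B ⟧ m ∎

  mulTerms-cong : ∀ {A A' B B'} → ⟦ A ⟧ ≗ ⟦ A' ⟧ → ⟦ B ⟧ ≗ ⟦ B' ⟧ →
                  ⟦ mulTerms A B ⟧ ≗ ⟦ mulTerms A' B' ⟧
  mulTerms-cong {A} {A'} {B} {B'} A≗A' B≗B' m =
    trans (sym (convolution-mulTerms A B m))
          (trans (convolution-cong A≗A' B≗B' m) (convolution-mulTerms A' B' m))

  terms : Poly → Terms
  terms (con c) = (c , (0 , 0 , 0 , 0)) ∷ []
  terms (var v) = (1ℤ , monoOf v) ∷ []
  terms (p ⊕ q) = terms p ++ terms q
  terms (p ⊗ q) = mulTerms (terms p) (terms q)

  unitMono≡ : ∀ m → unitMono m ≡ ((0 , 0 , 0 , 0) ==ₘ m)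
  unitMono≡ (suc a , b , c , d) = refl
  unitMono≡ (zero , suc b , c , d) = refl
  unitMono≡ (zero , zero , suc c , d) = refl
  unitMono≡ (zero , zero , zero , suc d) = refl
  unitMono≡ (zero , zero , zero , zero) = refl

  varMono≡ : ∀ v m → varMono v m ≡ (monoOf v ==ₘ m)
  varMono≡ w (zero , b , c , d) = refl
  varMono≡ w (suc (suc a) , b , c , d) = refl
  varMono≡ w (1 , suc b , c , d) = refl
  varMono≡ w (1 , zero , suc c , d) = refl
  varMono≡ w (1 , zero , zero , suc d) = refl
  varMono≡ w (1 , zero , zero , zero) = refl
  varMono≡ x (suc a , b , c , d) = refl
  varMono≡ x (zero , zero , c , d) = refl
  varMono≡ x (zero , suc (suc b) , c , d) = refl
  varMono≡ x (zero , 1 , suc c , d) = refl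
  varMono≡ x (zero , 1 , zero , suc d) = refl
  varMono≡ x (zero , 1 , zero , zero) = refl
  varMono≡ y (suc a , b , c , d) = refl
  varMono≡ y (zero , suc b , c , d) = refl
  varMono≡ y (zero , zero , zero , d) = refl
  varMono≡ y (zero , zero , suc (suc c) , d) = refl
  varMono≡ y (zero , zero , 1 , suc d) = refl
  varMono≡ y (zero , zero , 1 , zero) = refl
  varMono≡ z (suc a , b , c , d) = refl
  varMono≡ z (zero , suc b , c , d) = refl
  varMono≡ z (zero , zero , suc c , d) = refl
  varMono≡ z (zero , zero , zero , zero) = refl
  varMono≡ z (zero , zero , zero , suc (suc d)) = refl
  varMono≡ z (zero , zero , zero , 1) = refl

  coeff≗⟦terms⟧ : ∀ p → coeff p ≗ ⟦ terms p ⟧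
  coeff≗⟦terms⟧ (con c) m rewrite unitMono≡ m =
    trans (if≡δ (0 , 0 , 0 , 0) c m) (sym (ℤP.+-identityʳ _))
  coeff≗⟦terms⟧ (var v) m rewrite varMono≡ v m =
    trans (if≡δ (monoOf v) 1ℤ m) (sym (ℤP.+-identityʳ _))
  coeff≗⟦terms⟧ (p ⊕ q) m =
    trans (cong₂ _+_ (coeff≗⟦terms⟧ p m) (coeff≗⟦terms⟧ q m)) (sym (⟦⟧-++ (terms p) (terms q) m))
  coeff≗⟦terms⟧ (p ⊗ q) m =
    trans (sum-map-cong (λ { (m₁ , m₂) → cong₂ _*_ (coeff≗⟦terms⟧ p m₁) (coeff≗⟦terms⟧ q m₂) })
                        (divisors m))
          (convolution-mulTerms (terms p) (terms q) m)

module Derivation where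
  open Monomials
  open Polynomials
  open Data.Integer using (_+_; _*_)
  open import Data.Integer.Tactic.RingSolver using (solve-∀)
  open ℤΣ
  open ≡-Reasoning

  dMono : Var → Mono
  dMono w = (1 , 0 , 1 , 0)
  dMono x = (0 , 0 , 1 , 1)
  dMono y = (0 , 1 , 0 , 1)
  dMono z = (0 , 1 , 1 , 0)

  vars : List Var
  vars = w ∷ x ∷ y ∷ z ∷ []

  -- D (k·m) = Σ_v k·(∂m/∂v)·D v. If v does not occur in m, `lower` truncates and gives a junk
  -- monomial, but then the coefficient is 0.
  ∂term : Var → ℤ × Mono → ℤ × Mono
  ∂term v (k , m) = (k * ℤ.+ exponent v m , dMono v +ₘ lower v m)

  derivative : ℤ × Mono → Terms
  derivative t = map (λ v → ∂term v t) vars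

  derive : Terms → Terms
  derive = concatMap derivative

  preimage : Var → Mono → Mono
  preimage v m = raise v (m ∸ₘ dMono v)

  -- The v-part of D at m of a polynomial with coefficients f; the only monomial it can come
  -- from is preimage v m.
  Dcoeffᵥ : Var → (Mono → ℤ) → Mono → ℤ
  Dcoeffᵥ v f m =
    if does (dMono v ≤ₘ? m) then ℤ.+ exponent v (preimage v m) * f (preimage v m) else 0ℤ

  Dcoeff : (Mono → ℤ) → Mono → ℤ
  Dcoeff f m = sum (map (λ v → Dcoeffᵥ v f m) vars)

  Dcoeffᵥ-cong : ∀ v {f g} → f ≗ g → Dcoeffᵥ v f ≗ Dcoeffᵥ v g
  Dcoeffᵥ-cong v f≗g m with dMono v ≤ₘ? m
  ... | yes _ = cong (ℤ.+ exponent v (preimage v m) *_) (f≗g (preimage v m))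
  ... | no _ = refl

  Dcoeffᵥ-+ : ∀ v f g m → Dcoeffᵥ v (λ n → f n + g n) m ≡ Dcoeffᵥ v f m + Dcoeffᵥ v g m
  Dcoeffᵥ-+ v f g m with dMono v ≤ₘ? m
  ... | yes _ = ℤP.*-distribˡ-+ (ℤ.+ exponent v (preimage v m)) _ _
  ... | no _ = refl

  Dcoeffᵥ-0 : ∀ v m → Dcoeffᵥ v (λ _ → 0ℤ) m ≡ 0ℤ
  Dcoeffᵥ-0 v m with dMono v ≤ₘ? m
  ... | yes _ = ℤP.*-zeroʳ (ℤ.+ exponent v (preimage v m))
  ... | no _ = refl

  Dcoeff-cong : ∀ {f g} → f ≗ g → Dcoeff f ≗ Dcoeff g
  Dcoeff-cong f≗g m = sum-map-cong (λ v → Dcoeffᵥ-cong v f≗g m) vars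

  Dcoeff-+ : ∀ f g m → Dcoeff (λ n → f n + g n) m ≡ Dcoeff f m + Dcoeff g m
  Dcoeff-+ f g m = trans (sum-map-cong (λ v → Dcoeffᵥ-+ v f g m) vars)
                         (sum-map-+ (λ v → Dcoeffᵥ v f m) (λ v → Dcoeffᵥ v g m) vars)

  Dcoeff-0 : ∀ m → Dcoeff (λ _ → 0ℤ) m ≡ 0ℤ
  Dcoeff-0 m = trans (sum-map-cong (λ v → Dcoeffᵥ-0 v m) vars) (sum-map-0 vars)

  δ-∂term : ∀ v m₀ k → δ (dMono v +ₘ lower v m₀) (k * ℤ.+ exponent v m₀) ≗ Dcoeffᵥ v (δ m₀ k)
  δ-∂term v m₀ k m with dMono v ≤ₘ? m
  ... | no d≰m = δ-diff _ _ m (λ eq → d≰m (subst (dMono v ≤ₘ_) eq (≤ₘ-+ₘ (dMono v) (lower v m₀))))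
  ... | yes d≤m = begin
    δ (dMono v +ₘ lower v m₀) (k * E m₀) m   ≡⟨ transport (exponent v m₀) refl ⟩
    δ m₀ (k * E m₀) (preimage v m)           ≡⟨ sym (δ-weighted E m₀ k (preimage v m)) ⟩
    E (preimage v m) * δ m₀ k (preimage v m) ∎
    where
    E : Mono → ℤ
    E u = ℤ.+ exponent v u
    transport : ∀ e → exponent v m₀ ≡ e →
                δ (dMono v +ₘ lower v m₀) (k * E m₀) m ≡ δ m₀ (k * E m₀) (preimage v m)
    transport zero eq =
      trans (cong (λ c → δ (dMono v +ₘ lower v m₀) c m) k*E≡0)
            (trans (δ-0 _ m) (sym (trans (cong (λ c → δ m₀ c (preimage v m)) k*E≡0) (δ-0 m₀ _))))
      where
      k*E≡0 : k * E m₀ ≡ 0ℤ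
      k*E≡0 = trans (cong (λ e → k * ℤ.+ e) eq) (ℤP.*-zeroʳ k)
    transport (suc e) eq = δ-⇔ (k * E m₀) to from
      where
      to : dMono v +ₘ lower v m₀ ≡ m → m₀ ≡ preimage v m
      to refl = trans (sym (raise-lower v m₀ eq)) (cong (raise v) (sym (+ₘ-∸ₘ (dMono v) (lower v m₀))))
      from : m₀ ≡ preimage v m → dMono v +ₘ lower v m₀ ≡ m
      from refl = trans (cong (dMono v +ₘ_) (lower-raise v (m ∸ₘ dMono v))) (∸ₘ-+ₘ (dMono v) m d≤m)

  ⟦derivative⟧ : ∀ k m₀ → ⟦ derivative (k , m₀) ⟧ ≗ Dcoeff (δ m₀ k)
  ⟦derivative⟧ k m₀ m =
    trans (sum-map-∘ (λ v → ∂term v (k , m₀)) (evalTerm m) vars)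
          (sum-map-cong (λ v → δ-∂term v m₀ k m) vars)

  ⟦derive⟧ : ∀ A → ⟦ derive A ⟧ ≗ Dcoeff ⟦ A ⟧
  ⟦derive⟧ [] m = sym (Dcoeff-0 m)
  ⟦derive⟧ ((k , m₀) ∷ A) m = begin
    ⟦ derivative (k , m₀) ++ derive A ⟧ m              ≡⟨ ⟦⟧-++ (derivative (k , m₀)) (derive A) m ⟩
    ⟦ derivative (k , m₀) ⟧ m + ⟦ derive A ⟧ m         ≡⟨ cong₂ _+_ (⟦derivative⟧ k m₀ m) (⟦derive⟧ A m) ⟩
    Dcoeff (δ m₀ k) m + Dcoeff ⟦ A ⟧ m                 ≡⟨ sym (Dcoeff-+ (δ m₀ k) ⟦ A ⟧ m) ⟩
    Dcoeff ⟦ (k , m₀) ∷ A ⟧ m                          ∎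

  ∂term-leibniz : ∀ v k₀ m₀ k₁ m₁ →
    δ (dMono v +ₘ lower v (m₀ +ₘ m₁)) (k₀ * k₁ * ℤ.+ exponent v (m₀ +ₘ m₁))
    ≗ λ m → δ ((dMono v +ₘ lower v m₀) +ₘ m₁) (k₀ * ℤ.+ exponent v m₀ * k₁) m
            + δ (m₀ +ₘ (dMono v +ₘ lower v m₁)) (k₀ * (k₁ * ℤ.+ exponent v m₁)) m
  ∂term-leibniz v k₀ m₀ k₁ m₁ m = begin
    δ M (k₀ * k₁ * ℤ.+ exponent v (m₀ +ₘ m₁)) m
      ≡⟨ cong (λ c → δ M c m) coefficient-split ⟩
    δ M (C₀ + C₁) m
      ≡⟨ δ-+ M C₀ C₁ m ⟩
    δ M C₀ m + δ M C₁ m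
      ≡⟨ cong₂ _+_ (δ-resp C₀ left m) (δ-resp C₁ right m) ⟩
    δ ((dMono v +ₘ lower v m₀) +ₘ m₁) C₀ m + δ (m₀ +ₘ (dMono v +ₘ lower v m₁)) C₁ m ∎
    where
    M = dMono v +ₘ lower v (m₀ +ₘ m₁)
    C₀ = k₀ * ℤ.+ exponent v m₀ * k₁
    C₁ = k₀ * (k₁ * ℤ.+ exponent v m₁)
    distrib : ∀ a b p q → a * b * (p + q) ≡ a * p * b + a * (b * q)
    distrib = solve-∀
    coefficient-split : k₀ * k₁ * ℤ.+ exponent v (m₀ +ₘ m₁) ≡ C₀ + C₁
    coefficient-split =
      trans (cong (λ e → k₀ * k₁ * ℤ.+ e) (exponent-+ₘ v m₀ m₁))
            (trans (cong (k₀ * k₁ *_) (ℤP.pos-+ (exponent v m₀) (exponent v m₁)))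
                   (distrib k₀ k₁ (ℤ.+ exponent v m₀) (ℤ.+ exponent v m₁)))
    left : C₀ ≡ 0ℤ ⊎ M ≡ (dMono v +ₘ lower v m₀) +ₘ m₁
    left with lower-+ₘ v m₀ m₁
    ... | inj₁ e₀≡0 = inj₁ (trans (cong (λ e → k₀ * ℤ.+ e * k₁) e₀≡0)
                                  (trans (cong (_* k₁) (ℤP.*-zeroʳ k₀)) (ℤP.*-zeroˡ k₁)))
    ... | inj₂ eq = inj₂ (trans (cong (dMono v +ₘ_) eq) (sym (+ₘ-assoc (dMono v) (lower v m₀) m₁)))
    right : C₁ ≡ 0ℤ ⊎ M ≡ m₀ +ₘ (dMono v +ₘ lower v m₁)
    right with lower-+ₘ v m₁ m₀
    ... | inj₁ e₁≡0 = inj₁ (trans (cong (λ e → k₀ * (k₁ * ℤ.+ e)) e₁≡0)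
                                  (trans (cong (k₀ *_) (ℤP.*-zeroʳ k₁)) (ℤP.*-zeroʳ k₀)))
    ... | inj₂ eq = inj₂ (begin
      dMono v +ₘ lower v (m₀ +ₘ m₁)     ≡⟨ cong (λ u → dMono v +ₘ lower v u) (+ₘ-comm m₀ m₁) ⟩
      dMono v +ₘ lower v (m₁ +ₘ m₀)     ≡⟨ cong (dMono v +ₘ_) eq ⟩
      dMono v +ₘ (lower v m₁ +ₘ m₀)     ≡⟨ cong (dMono v +ₘ_) (+ₘ-comm (lower v m₁) m₀) ⟩
      dMono v +ₘ (m₀ +ₘ lower v m₁)     ≡⟨ sym (+ₘ-assoc (dMono v) m₀ (lower v m₁)) ⟩
      (dMono v +ₘ m₀) +ₘ lower v m₁     ≡⟨ cong (_+ₘ lower v m₁) (+ₘ-comm (dMono v) m₀) ⟩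
      (m₀ +ₘ dMono v) +ₘ lower v m₁     ≡⟨ +ₘ-assoc m₀ (dMono v) (lower v m₁) ⟩
      m₀ +ₘ (dMono v +ₘ lower v m₁)     ∎)

  derivative-product : ∀ k₀ m₀ k₁ m₁ →
    ⟦ derivative (k₀ * k₁ , m₀ +ₘ m₁) ⟧
    ≗ λ m → ⟦ mulTerms (derivative (k₀ , m₀)) ((k₁ , m₁) ∷ []) ⟧ m
            + ⟦ mulTerm k₀ m₀ (derivative (k₁ , m₁)) ⟧ m
  derivative-product k₀ m₀ k₁ m₁ m =
    trans (sum-map-cong (λ v → ∂term-leibniz v k₀ m₀ k₁ m₁ m) vars)
          (sum-map-+ (λ v → δ ((dMono v +ₘ lower v m₀) +ₘ m₁) (k₀ * ℤ.+ exponent v m₀ * k₁) m)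
                     (λ v → δ (m₀ +ₘ (dMono v +ₘ lower v m₁)) (k₀ * (k₁ * ℤ.+ exponent v m₁)) m) vars)

  derive-++ : ∀ A B → derive (A ++ B) ≡ derive A ++ derive B
  derive-++ = ListP.concatMap-++ derivative

  mulTerm-++ : ∀ k m₀ A B → mulTerm k m₀ (A ++ B) ≡ mulTerm k m₀ A ++ mulTerm k m₀ B
  mulTerm-++ k m₀ [] B = refl
  mulTerm-++ k m₀ ((k' , m₁) ∷ A) B = cong (_ ∷_) (mulTerm-++ k m₀ A B)

  mulTerms-++ : ∀ A A' B → mulTerms (A ++ A') B ≡ mulTerms A B ++ mulTerms A' B
  mulTerms-++ [] A' B = refl
  mulTerms-++ ((k , m₀) ∷ A) A' B =
    trans (cong (mulTerm k m₀ B ++_) (mulTerms-++ A A' B))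
          (sym (ListP.++-assoc (mulTerm k m₀ B) (mulTerms A B) (mulTerms A' B)))

  mulTerms-∷ʳ : ∀ A t B m →
                ⟦ mulTerms A (t ∷ B) ⟧ m ≡ ⟦ mulTerms A (t ∷ []) ⟧ m + ⟦ mulTerms A B ⟧ m
  mulTerms-∷ʳ A (k , m₁) B m = begin
    ⟦ mulTerms A ((k , m₁) ∷ B) ⟧ m
      ≡⟨ sym (convolution-mulTerms A ((k , m₁) ∷ B) m) ⟩
    convolution ⟦ A ⟧ (λ n → δ m₁ k n + ⟦ B ⟧ n) m
      ≡⟨ convolution-+ʳ ⟦ A ⟧ (δ m₁ k) ⟦ B ⟧ m ⟩
    convolution ⟦ A ⟧ (δ m₁ k) m + convolution ⟦ A ⟧ ⟦ B ⟧ m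
      ≡⟨ cong₂ _+_ (convolution-cong {⟦ A ⟧} (λ _ → refl) (λ n → sym (ℤP.+-identityʳ (δ m₁ k n))) m)
                   (convolution-mulTerms A B m) ⟩
    convolution ⟦ A ⟧ ⟦ (k , m₁) ∷ [] ⟧ m + ⟦ mulTerms A B ⟧ m
      ≡⟨ cong (_+ ⟦ mulTerms A B ⟧ m) (convolution-mulTerms A ((k , m₁) ∷ []) m) ⟩
    ⟦ mulTerms A ((k , m₁) ∷ []) ⟧ m + ⟦ mulTerms A B ⟧ m ∎

  +-interchange : ∀ a b c d → (a + b) + (c + d) ≡ (a + c) + (b + d)
  +-interchange = solve-∀

  derive-mulTerm : ∀ k m₀ B →
    ⟦ derive (mulTerm k m₀ B) ⟧
    ≗ λ m → ⟦ mulTerms (derivative (k , m₀)) B ⟧ m + ⟦ mulTerm k m₀ (derive B) ⟧ m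
  derive-mulTerm k m₀ [] m = refl
  derive-mulTerm k m₀ ((k' , m₁) ∷ B) m = begin
    ⟦ derivative (k * k' , m₀ +ₘ m₁) ++ derive (mulTerm k m₀ B) ⟧ m
      ≡⟨ ⟦⟧-++ (derivative (k * k' , m₀ +ₘ m₁)) (derive (mulTerm k m₀ B)) m ⟩
    ⟦ derivative (k * k' , m₀ +ₘ m₁) ⟧ m + ⟦ derive (mulTerm k m₀ B) ⟧ m
      ≡⟨ cong₂ _+_ (derivative-product k m₀ k' m₁ m) (derive-mulTerm k m₀ B m) ⟩
    (P₁ + Q₁) + (P₂ + Q₂)
      ≡⟨ +-interchange P₁ Q₁ P₂ Q₂ ⟩
    (P₁ + P₂) + (Q₁ + Q₂)
      ≡⟨ cong₂ _+_ (sym (mulTerms-∷ʳ (derivative (k , m₀)) (k' , m₁) B m)) (sym Q-split) ⟩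
    ⟦ mulTerms (derivative (k , m₀)) ((k' , m₁) ∷ B) ⟧ m
      + ⟦ mulTerm k m₀ (derive ((k' , m₁) ∷ B)) ⟧ m ∎
    where
    P₁ = ⟦ mulTerms (derivative (k , m₀)) ((k' , m₁) ∷ []) ⟧ m
    Q₁ = ⟦ mulTerm k m₀ (derivative (k' , m₁)) ⟧ m
    P₂ = ⟦ mulTerms (derivative (k , m₀)) B ⟧ m
    Q₂ = ⟦ mulTerm k m₀ (derive B) ⟧ m
    Q-split : ⟦ mulTerm k m₀ (derivative (k' , m₁) ++ derive B) ⟧ m ≡ Q₁ + Q₂
    Q-split = trans (cong (λ A → ⟦ A ⟧ m) (mulTerm-++ k m₀ (derivative (k' , m₁)) (derive B)))
                    (⟦⟧-++ (mulTerm k m₀ (derivative (k' , m₁))) (mulTerm k m₀ (derive B)) m)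

  derive-mulTerms : ∀ A B →
    ⟦ derive (mulTerms A B) ⟧ ≗ λ m → ⟦ mulTerms (derive A) B ⟧ m + ⟦ mulTerms A (derive B) ⟧ m
  derive-mulTerms [] B m = refl
  derive-mulTerms ((k , m₀) ∷ A) B m = begin
    ⟦ derive (mulTerm k m₀ B ++ mulTerms A B) ⟧ m
      ≡⟨ cong (λ L → ⟦ L ⟧ m) (derive-++ (mulTerm k m₀ B) (mulTerms A B)) ⟩
    ⟦ derive (mulTerm k m₀ B) ++ derive (mulTerms A B) ⟧ m
      ≡⟨ ⟦⟧-++ (derive (mulTerm k m₀ B)) (derive (mulTerms A B)) m ⟩
    ⟦ derive (mulTerm k m₀ B) ⟧ m + ⟦ derive (mulTerms A B) ⟧ m
      ≡⟨ cong₂ _+_ (derive-mulTerm k m₀ B m) (derive-mulTerms A B m) ⟩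
    (P + Q) + (R + S)
      ≡⟨ +-interchange P Q R S ⟩
    (P + R) + (Q + S)
      ≡⟨ cong₂ _+_ (sym P-R) (sym (⟦⟧-++ (mulTerm k m₀ (derive B)) (mulTerms A (derive B)) m)) ⟩
    ⟦ mulTerms (derive ((k , m₀) ∷ A)) B ⟧ m + ⟦ mulTerms ((k , m₀) ∷ A) (derive B) ⟧ m ∎
    where
    P = ⟦ mulTerms (derivative (k , m₀)) B ⟧ m
    Q = ⟦ mulTerm k m₀ (derive B) ⟧ m
    R = ⟦ mulTerms (derive A) B ⟧ m
    S = ⟦ mulTerms A (derive B) ⟧ m
    P-R : ⟦ mulTerms (derivative (k , m₀) ++ derive A) B ⟧ m ≡ P + R
    P-R = trans (cong (λ L → ⟦ L ⟧ m) (mulTerms-++ (derivative (k , m₀)) (derive A) B))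
                (⟦⟧-++ (mulTerms (derivative (k , m₀)) B) (mulTerms (derive A) B) m)

  ⟦⟧-0 : ∀ A → All (λ t → proj₁ t ≡ 0ℤ) A → ⟦ A ⟧ ≗ λ _ → 0ℤ
  ⟦⟧-0 [] [] m = refl
  ⟦⟧-0 ((k , m₀) ∷ A) (refl ∷ A≡0) m = trans (cong₂ _+_ (δ-0 m₀ m) (⟦⟧-0 A A≡0 m)) refl

  ⟦terms-Dvar⟧ : ∀ v → ⟦ terms (Dvar v) ⟧ ≗ ⟦ derive (terms (var v)) ⟧
  ⟦terms-Dvar⟧ w m =
    cong (δ (1 , 0 , 1 , 0) 1ℤ m +_)
      (sym (⟦⟧-0 ((0ℤ , (1 , 0 , 1 , 1)) ∷ (0ℤ , (1 , 1 , 0 , 1)) ∷ (0ℤ , (1 , 1 , 1 , 0)) ∷ [])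
                 (refl ∷ refl ∷ refl ∷ []) m))
  ⟦terms-Dvar⟧ x m = sym (begin
    ⟦ (0ℤ , (1 , 1 , 1 , 0)) ∷ (1ℤ , (0 , 0 , 1 , 1)) ∷ zeros ⟧ m
      ≡⟨ ⟦⟧-0∷ (1 , 1 , 1 , 0) ((1ℤ , (0 , 0 , 1 , 1)) ∷ zeros) m ⟩
    δ (0 , 0 , 1 , 1) 1ℤ m + ⟦ zeros ⟧ m
      ≡⟨ cong (δ (0 , 0 , 1 , 1) 1ℤ m +_) (⟦⟧-0 zeros (refl ∷ refl ∷ []) m) ⟩
    δ (0 , 0 , 1 , 1) 1ℤ m + 0ℤ                                 ∎)
    where
    zeros : Terms
    zeros = (0ℤ , (0 , 2 , 0 , 1)) ∷ (0ℤ , (0 , 2 , 1 , 0)) ∷ []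
  ⟦terms-Dvar⟧ y m = sym (begin
    ⟦ (0ℤ , (1 , 0 , 2 , 0)) ∷ (0ℤ , (0 , 0 , 2 , 1)) ∷ rest ⟧ m
      ≡⟨ ⟦⟧-0∷ (1 , 0 , 2 , 0) ((0ℤ , (0 , 0 , 2 , 1)) ∷ rest) m ⟩
    ⟦ (0ℤ , (0 , 0 , 2 , 1)) ∷ rest ⟧ m
      ≡⟨ ⟦⟧-0∷ (0 , 0 , 2 , 1) rest m ⟩
    δ (0 , 1 , 0 , 1) 1ℤ m + ⟦ (0ℤ , (0 , 1 , 2 , 0)) ∷ [] ⟧ m
      ≡⟨ cong (δ (0 , 1 , 0 , 1) 1ℤ m +_) (⟦⟧-0∷ (0 , 1 , 2 , 0) [] m) ⟩
    δ (0 , 1 , 0 , 1) 1ℤ m + 0ℤ                                 ∎)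
    where
    rest : Terms
    rest = (1ℤ , (0 , 1 , 0 , 1)) ∷ (0ℤ , (0 , 1 , 2 , 0)) ∷ []
  ⟦terms-Dvar⟧ z m = sym (begin
    ⟦ (0ℤ , (1 , 0 , 1 , 1)) ∷ (0ℤ , (0 , 0 , 1 , 2)) ∷ (0ℤ , (0 , 1 , 0 , 2)) ∷ last ⟧ m
      ≡⟨ ⟦⟧-0∷ (1 , 0 , 1 , 1) ((0ℤ , (0 , 0 , 1 , 2)) ∷ (0ℤ , (0 , 1 , 0 , 2)) ∷ last) m ⟩
    ⟦ (0ℤ , (0 , 0 , 1 , 2)) ∷ (0ℤ , (0 , 1 , 0 , 2)) ∷ last ⟧ m
      ≡⟨ ⟦⟧-0∷ (0 , 0 , 1 , 2) ((0ℤ , (0 , 1 , 0 , 2)) ∷ last) m ⟩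
    ⟦ (0ℤ , (0 , 1 , 0 , 2)) ∷ last ⟧ m
      ≡⟨ ⟦⟧-0∷ (0 , 1 , 0 , 2) last m ⟩
    ⟦ last ⟧ m ∎)
    where
    last : Terms
    last = (1ℤ , (0 , 1 , 1 , 0)) ∷ []

  ⟦terms-D⟧ : ∀ p → ⟦ terms (D p) ⟧ ≗ ⟦ derive (terms p) ⟧
  ⟦terms-D⟧ (con c) m =
    trans (⟦⟧-0 (terms (con 0ℤ)) (refl ∷ []) m)
          (sym (⟦⟧-0 (derive (terms (con c))) (c*0 ∷ c*0 ∷ c*0 ∷ c*0 ∷ []) m))
    where
    c*0 : c * 0ℤ ≡ 0ℤ
    c*0 = ℤP.*-zeroʳ c
  ⟦terms-D⟧ (var v) = ⟦terms-Dvar⟧ v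
  ⟦terms-D⟧ (p ⊕ q) m = begin
    ⟦ terms (D p) ++ terms (D q) ⟧ m
      ≡⟨ ⟦⟧-++ (terms (D p)) (terms (D q)) m ⟩
    ⟦ terms (D p) ⟧ m + ⟦ terms (D q) ⟧ m
      ≡⟨ cong₂ _+_ (⟦terms-D⟧ p m) (⟦terms-D⟧ q m) ⟩
    ⟦ derive (terms p) ⟧ m + ⟦ derive (terms q) ⟧ m
      ≡⟨ sym (⟦⟧-++ (derive (terms p)) (derive (terms q)) m) ⟩
    ⟦ derive (terms p) ++ derive (terms q) ⟧ m
      ≡⟨ cong (λ L → ⟦ L ⟧ m) (sym (derive-++ (terms p) (terms q))) ⟩
    ⟦ derive (terms p ++ terms q) ⟧ m                ∎
  ⟦terms-D⟧ (p ⊗ q) m = begin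
    ⟦ mulTerms (terms (D p)) (terms q) ++ mulTerms (terms p) (terms (D q)) ⟧ m
      ≡⟨ ⟦⟧-++ (mulTerms (terms (D p)) (terms q)) (mulTerms (terms p) (terms (D q))) m ⟩
    ⟦ mulTerms (terms (D p)) (terms q) ⟧ m + ⟦ mulTerms (terms p) (terms (D q)) ⟧ m
      ≡⟨ cong₂ _+_ (mulTerms-cong {terms (D p)} {derive (terms p)} {terms q} {terms q} (⟦terms-D⟧ p) (λ _ → refl) m)
                   (mulTerms-cong {terms p} {terms p} {terms (D q)} {derive (terms q)} (λ _ → refl) (⟦terms-D⟧ q) m) ⟩
    ⟦ mulTerms (derive (terms p)) (terms q) ⟧ m + ⟦ mulTerms (terms p) (derive (terms q)) ⟧ m
      ≡⟨ sym (derive-mulTerms (terms p) (terms q) m) ⟩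
    ⟦ derive (mulTerms (terms p) (terms q)) ⟧ m ∎

  coeff-D : ∀ p → coeff (D p) ≗ Dcoeff (coeff p)
  coeff-D p m = begin
    coeff (D p) m                ≡⟨ coeff≗⟦terms⟧ (D p) m ⟩
    ⟦ terms (D p) ⟧ m            ≡⟨ ⟦terms-D⟧ p m ⟩
    ⟦ derive (terms p) ⟧ m       ≡⟨ ⟦derive⟧ (terms p) m ⟩
    Dcoeff ⟦ terms p ⟧ m         ≡⟨ sym (Dcoeff-cong (coeff≗⟦terms⟧ p) m) ⟩
    Dcoeff (coeff p) m           ∎

module Trees where
  open Data.Nat using (_+_)

  mutual
    flatten : LTree → List ℕ
    flatten (node l cs) = l ∷ flattenF cs

    flattenF : List LTree → List ℕ
    flattenF [] = []
    flattenF (t ∷ ts) = flatten t ++ flattenF ts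

  mutual
    size : LTree → ℕ
    size (node l cs) = suc (sizeF cs)

    sizeF : List LTree → ℕ
    sizeF [] = 0
    sizeF (t ∷ ts) = size t + sizeF ts

  -- Defs appends labels with a private copy of _++_; these equations characterise _++_.
  ++-unique : {f : List ℕ → List ℕ → List ℕ} → (∀ ys → f [] ys ≡ ys) →
              (∀ a xs ys → f (a ∷ xs) ys ≡ a ∷ f xs ys) → ∀ xs ys → f xs ys ≡ xs ++ ys
  ++-unique f[] f∷ [] ys = f[] ys
  ++-unique f[] f∷ (a ∷ xs) ys = trans (f∷ a xs ys) (cong (a ∷_) (++-unique f[] f∷ xs ys))

  labelsF-∷ : ∀ t ts → labelsF (t ∷ ts) ≡ labels t ++ labelsF ts
  labelsF-∷ t ts with labels t | labelsF ts | ++-unique (λ _ → refl) (λ _ _ _ → refl)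
  ... | xs | ys | append≡++ = append≡++ xs ys

  mutual
    labels≡flatten : ∀ t → labels t ≡ flatten t
    labels≡flatten (node l cs) = cong (l ∷_) (labelsF≡flattenF cs)

    labelsF≡flattenF : ∀ ts → labelsF ts ≡ flattenF ts
    labelsF≡flattenF [] = refl
    labelsF≡flattenF (t ∷ ts) = trans (labelsF-∷ t ts) (cong₂ _++_ (labels≡flatten t) (labelsF≡flattenF ts))

  flattenF-++ : ∀ ts us → flattenF (ts ++ us) ≡ flattenF ts ++ flattenF us
  flattenF-++ [] us = refl
  flattenF-++ (t ∷ ts) us =
    trans (cong (flatten t ++_) (flattenF-++ ts us)) (sym (ListP.++-assoc (flatten t) (flattenF ts) (flattenF us)))

  sizeF-++ : ∀ ts us → sizeF (ts ++ us) ≡ sizeF ts + sizeF us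
  sizeF-++ [] us = refl
  sizeF-++ (t ∷ ts) us = trans (cong (size t +_) (sizeF-++ ts us)) (sym (ℕP.+-assoc (size t) (sizeF ts) (sizeF us)))

  mutual
    size≡length : ∀ t → size t ≡ length (flatten t)
    size≡length (node l cs) = cong suc (sizeF≡length cs)

    sizeF≡length : ∀ ts → sizeF ts ≡ length (flattenF ts)
    sizeF≡length [] = refl
    sizeF≡length (t ∷ ts) = trans (cong₂ _+_ (size≡length t) (sizeF≡length ts)) (sym (ListP.length-++ (flatten t)))

module Statistics where
  open Monomials using (_+ₘ_; monoOf; mono≡)
  open ℕΣ using () renaming (ind to indℕ)

  isEven : ℕ → Bool
  isEven zero = true
  isEven (suc n) = not (isEven n)

  -- Defs keeps its parity test private; the node predicates of the statistics are recovered by unification.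
  nodePredicate : (f : LTree → ℕ) {P : ℕ → ℕ → Bool} → f ≡ nonRootCount P → ℕ → ℕ → Bool
  nodePredicate _ {P} _ = P

  isEE isOE isOdd : ℕ → ℕ → Bool
  isEE = nodePredicate ee* refl
  isOE = nodePredicate oe* refl
  isOdd = nodePredicate odd* refl

  private
    parity : ∀ n → isEE 0 n ≡ isEven n
    parity zero = refl
    parity (suc n) = cong not (parity n)

  isEE≡ : ∀ d l → isEE d l ≡ isEven d ∧ isEven l
  isEE≡ d l rewrite parity d | parity l = refl

  isOE≡ : ∀ d l → isOE d l ≡ isEven d ∧ not (isEven l)
  isOE≡ d l rewrite parity d | parity l = refl

  isOdd≡ : ∀ d l → isOdd d l ≡ not (isEven d)
  isOdd≡ d l rewrite parity d = refl

  nodeWt : ℕ → ℕ → Mono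
  nodeWt d l = (0 , indℕ (isEE d l) , indℕ (isOE d l) , indℕ (isOdd d l))

  wt : ℕ → List LTree → Mono
  wt l ts = (0 , countNR isEE l ts , countNR isOE l ts , countNR isOdd l ts)

  weight : LTree → Mono
  weight T = (1 , ee* T , oe* T , odd* T)

  countNR-++ : ∀ P l ts us → countNR P l (ts ++ us) ≡ countNR P l ts ℕ.+ countNR P l us
  countNR-++ P l [] us = refl
  countNR-++ P l (node _ cs ∷ ts) us =
    trans (cong (indℕ (P (length cs) l) ℕ.+ countNR P (suc l) cs ℕ.+_) (countNR-++ P l ts us))
          (sym (ℕP.+-assoc (indℕ (P (length cs) l) ℕ.+ countNR P (suc l) cs) _ _))

  wt-++ : ∀ l ts us → wt l (ts ++ us) ≡ wt l ts +ₘ wt l us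
  wt-++ l ts us = mono≡ refl (countNR-++ isEE l ts us) (countNR-++ isOE l ts us) (countNR-++ isOdd l ts us)

  wt-leaf : ∀ l n → wt l (node n [] ∷ []) ≡ nodeWt 0 l
  wt-leaf l n = mono≡ refl (+0+0 _) (+0+0 _) (+0+0 _)
    where
    +0+0 : ∀ i → i ℕ.+ 0 ℕ.+ 0 ≡ i
    +0+0 i = trans (ℕP.+-identityʳ (i ℕ.+ 0)) (ℕP.+-identityʳ i)

  typeWt : Bool → Bool → Mono
  typeWt true  true  = monoOf x
  typeWt true  false = monoOf y
  typeWt false _     = monoOf z

  nodeWt≡typeWt : ∀ d l → nodeWt d l ≡ typeWt (isEven d) (isEven l)
  nodeWt≡typeWt d l rewrite isEE≡ d l | isOE≡ d l | isOdd≡ d l with isEven d | isEven l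
  ... | true  | true  = refl
  ... | true  | false = refl
  ... | false | true  = refl
  ... | false | false = refl

module Insertion where

  mutual
    addLeaf : ℕ → LTree → List LTree
    addLeaf N (node l cs) = node l (cs ++ node N [] ∷ []) ∷ map (node l) (addLeafF N cs)

    addLeafF : ℕ → List LTree → List (List LTree)
    addLeafF N [] = []
    addLeafF N (t ∷ ts) = map (_∷ ts) (addLeaf N t) ++ map (t ∷_) (addLeafF N ts)

  addLeafF-length : ∀ N cs cs' → cs' ∈ addLeafF N cs → length cs' ≡ length cs
  addLeafF-length N (t ∷ ts) cs' cs'∈ with ∈P.∈-++⁻ (map (_∷ ts) (addLeaf N t)) cs'∈
  ... | inj₁ ∈head with ∈P.∈-map⁻ (_∷ ts) ∈head
  ...   | _ , _ , refl = refl
  addLeafF-length N (t ∷ ts) cs' cs'∈ | inj₂ ∈tail with ∈P.∈-map⁻ (t ∷_) ∈tail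
  ...   | ts' , ts'∈ , refl = cong suc (addLeafF-length N ts ts' ts'∈)

module Weights (m : Mono) where
  open Monomials
  open Polynomials
  open Derivation
  open Statistics
  open Insertion
  open Data.Integer using (_+_; _*_)
  open import Data.Integer.Tactic.RingSolver using (solve-∀)
  open ℤΣ
  open ≡-Reasoning

  val : Mono → ℤ
  val M = δ M 1ℤ m

  xyz : List Var
  xyz = x ∷ y ∷ z ∷ []

  -- ∂ k M: the coefficient at m of the derivative of M in which only the occurrences of x, y, z
  -- counted by k are differentiated.
  ∂ : Mono → Mono → ℤ
  ∂ k M = sum (map (λ v → ℤ.+ exponent v k * val (dMono v +ₘ lower v M)) xyz)

  ∂-+ : ∀ k k' M → ∂ (k +ₘ k') M ≡ ∂ k M + ∂ k' M
  ∂-+ k k' M =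
    trans (sum-map-cong term-+ xyz)
          (sum-map-+ (λ v → ℤ.+ exponent v k * V v) (λ v → ℤ.+ exponent v k' * V v) xyz)
    where
    V : Var → ℤ
    V v = val (dMono v +ₘ lower v M)
    term-+ : ∀ v → ℤ.+ exponent v (k +ₘ k') * V v ≡ ℤ.+ exponent v k * V v + ℤ.+ exponent v k' * V v
    term-+ v = trans (cong (λ e → ℤ.+ e * V v) (exponent-+ₘ v k k'))
                     (trans (cong (_* V v) (ℤP.pos-+ (exponent v k) (exponent v k')))
                            (ℤP.*-distribʳ-+ (V v) (ℤ.+ exponent v k) (ℤ.+ exponent v k')))

  ∂-monoOf : ∀ {v} → v ∈ xyz → ∀ R → ∂ (monoOf v) (R +ₘ monoOf v) ≡ val (R +ₘ dMono v)
  ∂-monoOf {v} v∈xyz R =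
    trans (∂-unit v∈xyz (R +ₘ monoOf v))
          (cong val (trans (cong (dMono v +ₘ_) (lower-+ₘ-monoOf v R)) (+ₘ-comm (dMono v) R)))
    where
    first : ∀ a b c → ℤ.+ 1 * a + (ℤ.+ 0 * b + (ℤ.+ 0 * c + 0ℤ)) ≡ a
    first = solve-∀
    second : ∀ a b c → ℤ.+ 0 * a + (ℤ.+ 1 * b + (ℤ.+ 0 * c + 0ℤ)) ≡ b
    second = solve-∀
    third : ∀ a b c → ℤ.+ 0 * a + (ℤ.+ 0 * b + (ℤ.+ 1 * c + 0ℤ)) ≡ c
    third = solve-∀
    V : Var → Mono → ℤ
    V u M = val (dMono u +ₘ lower u M)
    ∂-unit : ∀ {v} → v ∈ xyz → ∀ M → ∂ (monoOf v) M ≡ val (dMono v +ₘ lower v M)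
    ∂-unit (here refl) M = first (V x M) (V y M) (V z M)
    ∂-unit (there (here refl)) M = second (V x M) (V y M) (V z M)
    ∂-unit (there (there (here refl))) M = third (V x M) (V y M) (V z M)

  typeWt-gains-child : ∀ p q R →
    val (R +ₘ (typeWt (not p) q +ₘ typeWt true (not q))) ≡ ∂ (typeWt p q) (R +ₘ typeWt p q)
  typeWt-gains-child true  true  R = sym (∂-monoOf (here refl) R)
  typeWt-gains-child true  false R = sym (∂-monoOf (there (here refl)) R)
  typeWt-gains-child false true  R = sym (∂-monoOf (there (there (here refl))) R)
  typeWt-gains-child false false R = sym (∂-monoOf (there (there (here refl))) R)

  node-gains-child : ∀ d l R →
    val (R +ₘ (nodeWt (suc d) l +ₘ nodeWt 0 (suc l))) ≡ ∂ (nodeWt d l) (R +ₘ nodeWt d l)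
  node-gains-child d l R = gains (nodeWt≡typeWt (suc d) l) (nodeWt≡typeWt 0 (suc l)) (nodeWt≡typeWt d l)
    where
    gains : ∀ {a b c} → a ≡ typeWt (not (isEven d)) (isEven l) → b ≡ typeWt true (not (isEven l)) →
            c ≡ typeWt (isEven d) (isEven l) → val (R +ₘ (a +ₘ b)) ≡ ∂ c (R +ₘ c)
    gains refl refl refl = typeWt-gains-child (isEven d) (isEven l) R

  module _ (N : ℕ) where
    open import Algebra.Solver.CommutativeMonoid +ₘ-commutativeMonoid using (solve; _⊜_) renaming (_⊕_ to _⊙_)

    -- The forests tss sit at level l inside a tree whose other nodes contribute the offset o.
    Σval : ℕ → Mono → List (List LTree) → ℤ
    Σval l o tss = sum (map (λ ts → val (o +ₘ wt l ts)) tss)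

    attach-first-root : ∀ l l' cs ts o →
      val (o +ₘ wt l (node l' (cs ++ node N [] ∷ []) ∷ ts))
      ≡ ∂ (nodeWt (length cs) l) (o +ₘ wt l (node l' cs ∷ ts))
    attach-first-root l l' cs ts o = begin
      val (o +ₘ ((nodeWt (length (cs ++ node N [] ∷ [])) l +ₘ wt (suc l) (cs ++ node N [] ∷ [])) +ₘ tw))
        ≡⟨ cong (λ u → val (o +ₘ (u +ₘ tw))) (cong₂ _+ₘ_ (cong (λ k → nodeWt k l) (ListP.length-++ cs))
             (trans (wt-++ (suc l) cs (node N [] ∷ [])) (cong (c +ₘ_) (wt-leaf (suc l) N)))) ⟩
      val (o +ₘ ((nodeWt (length cs ℕ.+ 1) l +ₘ (c +ₘ nodeWt 0 (suc l))) +ₘ tw))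
        ≡⟨ cong val (rearrange o (nodeWt (length cs ℕ.+ 1) l) (nodeWt 0 (suc l)) c tw) ⟩
      val (R +ₘ (nodeWt (length cs ℕ.+ 1) l +ₘ nodeWt 0 (suc l)))
        ≡⟨ cong (λ k → val (R +ₘ (nodeWt k l +ₘ nodeWt 0 (suc l)))) (ℕP.+-comm (length cs) 1) ⟩
      val (R +ₘ (nodeWt (suc (length cs)) l +ₘ nodeWt 0 (suc l)))
        ≡⟨ node-gains-child (length cs) l R ⟩
      ∂ n (R +ₘ n)
        ≡⟨ cong (∂ n) (regroup o n c tw) ⟩
      ∂ n (o +ₘ ((n +ₘ c) +ₘ tw)) ∎
      where
      n = nodeWt (length cs) l
      c = wt (suc l) cs
      tw = wt l ts
      R = (o +ₘ c) +ₘ tw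
      rearrange : ∀ o n' ℓ c t → o +ₘ ((n' +ₘ (c +ₘ ℓ)) +ₘ t) ≡ ((o +ₘ c) +ₘ t) +ₘ (n' +ₘ ℓ)
      rearrange = solve 5 (λ o n' ℓ c t → o ⊙ ((n' ⊙ (c ⊙ ℓ)) ⊙ t) ⊜ ((o ⊙ c) ⊙ t) ⊙ (n' ⊙ ℓ)) refl
      regroup : ∀ o n c t → ((o +ₘ c) +ₘ t) +ₘ n ≡ o +ₘ ((n +ₘ c) +ₘ t)
      regroup = solve 4 (λ o n c t → ((o ⊙ c) ⊙ t) ⊙ n ⊜ o ⊙ ((n ⊙ c) ⊙ t)) refl

    Σval-cons : ∀ l t o X → Σval l o (map (t ∷_) X) ≡ Σval l (o +ₘ wt l (t ∷ [])) X
    Σval-cons l t@(node _ cs) o X = trans (sum-map-∘ (t ∷_) _ X) (sum-map-cong (λ ts' →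
      cong val (trans (cong (λ u → o +ₘ (u +ₘ wt l ts')) (sym (+ₘ-identityʳ _)))
                      (sym (+ₘ-assoc o _ (wt l ts'))))) X)

    Σval-inside : ∀ l l' cs ts o → Σval l o (map (_∷ ts) (map (node l') (addLeafF N cs)))
                                   ≡ Σval (suc l) (o +ₘ (nodeWt (length cs) l +ₘ wt l ts)) (addLeafF N cs)
    Σval-inside l l' cs ts o = begin
      Σval l o (map (_∷ ts) (map (node l') (addLeafF N cs)))
        ≡⟨ trans (sum-map-∘ (_∷ ts) _ (map (node l') (addLeafF N cs))) (sum-map-∘ (node l') _ (addLeafF N cs)) ⟩
      sum (map (λ cs' → val (o +ₘ ((nodeWt (length cs') l +ₘ wt (suc l) cs') +ₘ wt l ts))) (addLeafF N cs))
        ≡⟨ sum-map-cong∈ (addLeafF N cs) (λ cs' cs'∈ →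
             cong val (trans (cong (λ k → o +ₘ ((nodeWt k l +ₘ wt (suc l) cs') +ₘ wt l ts))
                                   (addLeafF-length N cs cs' cs'∈))
                             (swap o (nodeWt (length cs) l) (wt (suc l) cs') (wt l ts)))) ⟩
      Σval (suc l) (o +ₘ (nodeWt (length cs) l +ₘ wt l ts)) (addLeafF N cs) ∎
      where
      swap : ∀ o n c t → o +ₘ ((n +ₘ c) +ₘ t) ≡ (o +ₘ (n +ₘ t)) +ₘ c
      swap = solve 4 (λ o n c t → o ⊙ ((n ⊙ c) ⊙ t) ⊜ (o ⊙ (n ⊙ t)) ⊙ c) refl

    Σ-addLeafF : ∀ l ts o → Σval l o (addLeafF N ts) ≡ ∂ (wt l ts) (o +ₘ wt l ts)
    Σ-addLeafF l [] o = refl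
    Σ-addLeafF l (t@(node l' cs) ∷ ts) o = begin
      Σval l o (map (_∷ ts) (addLeaf N t) ++ map (t ∷_) (addLeafF N ts))
        ≡⟨ sum-map-++ (λ ts' → val (o +ₘ wt l ts')) (map (_∷ ts) (addLeaf N t)) (map (t ∷_) (addLeafF N ts)) ⟩
      val (o +ₘ wt l (node l' (cs ++ node N [] ∷ []) ∷ ts)) + Σval l o (map (_∷ ts) (map (node l') (addLeafF N cs)))
        + Σval l o (map (t ∷_) (addLeafF N ts))
        ≡⟨ cong₂ _+_ (cong₂ _+_ (attach-first-root l l' cs ts o) (Σval-inside l l' cs ts o))
                     (Σval-cons l t o (addLeafF N ts)) ⟩
      ∂ n W + Σval (suc l) (o +ₘ (n +ₘ tw)) (addLeafF N cs) + Σval l (o +ₘ wt l (t ∷ [])) (addLeafF N ts)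
        ≡⟨ cong₂ _+_ (cong (∂ n W +_) (Σ-addLeafF (suc l) cs (o +ₘ (n +ₘ tw))))
                     (Σ-addLeafF l ts (o +ₘ wt l (t ∷ []))) ⟩
      ∂ n W + ∂ c ((o +ₘ (n +ₘ tw)) +ₘ c) + ∂ tw ((o +ₘ wt l (t ∷ [])) +ₘ tw)
        ≡⟨ cong₂ _+_ (cong (∂ n W +_) (cong (∂ c) (regroup₁ o n c tw))) (cong (∂ tw) (regroup₂ o n c tw)) ⟩
      ∂ n W + ∂ c W + ∂ tw W
        ≡⟨ trans (cong (_+ ∂ tw W) (sym (∂-+ n c W))) (sym (∂-+ (n +ₘ c) tw W)) ⟩
      ∂ ((n +ₘ c) +ₘ tw) W ∎
      where
      n = nodeWt (length cs) l
      c = wt (suc l) cs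
      tw = wt l ts
      W = o +ₘ ((n +ₘ c) +ₘ tw)
      regroup₁ : ∀ o n c t → (o +ₘ (n +ₘ t)) +ₘ c ≡ o +ₘ ((n +ₘ c) +ₘ t)
      regroup₁ = solve 4 (λ o n c t → (o ⊙ (n ⊙ t)) ⊙ c ⊜ o ⊙ ((n ⊙ c) ⊙ t)) refl
      regroup₂ : ∀ o n c t → (o +ₘ ((n +ₘ c) +ₘ (0 , 0 , 0 , 0))) +ₘ t ≡ o +ₘ ((n +ₘ c) +ₘ t)
      regroup₂ o n c t = trans (cong (λ u → (o +ₘ u) +ₘ t) (+ₘ-identityʳ (n +ₘ c))) (+ₘ-assoc o (n +ₘ c) t)

    Σ-addLeaf : ∀ T → sum (map (val ∘ weight) (addLeaf N T)) ≡ ⟦ derivative (1ℤ , weight T) ⟧ m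
    Σ-addLeaf T@(node l cs) = begin
      val (weight grown) + sum (map (val ∘ weight) (map (node l) (addLeafF N cs)))
        ≡⟨ cong₂ _+_ (cong val grown-weight) (trans (sum-map-∘ (node l) (val ∘ weight) (addLeafF N cs))
                                                    (Σ-addLeafF 1 cs (1 , 0 , 0 , 0))) ⟩
      val (dMono w +ₘ lower w W) + ∂ (wt 1 cs) W
        ≡⟨ cong (val (dMono w +ₘ lower w W) +_) (sym (sum-map-cong δ-scalar xyz)) ⟩
      ⟦ derivative (1ℤ , W) ⟧ m ∎
      where
      grown = node l (cs ++ node N [] ∷ [])
      W = weight (node l cs)
      grown-weight : weight grown ≡ dMono w +ₘ lower w W
      grown-weight =
        trans (cong ((1 , 0 , 0 , 0) +ₘ_) (trans (wt-++ 1 cs (node N [] ∷ [])) (cong (wt 1 cs +ₘ_) (wt-leaf 1 N))))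
              (mono≡ refl (ℕP.+-identityʳ (ee* T)) (ℕP.+-comm (oe* T) 1) (ℕP.+-identityʳ (odd* T)))
      δ-scalar : ∀ v → δ (dMono v +ₘ lower v W) (1ℤ * ℤ.+ exponent v W) m
                       ≡ ℤ.+ exponent v W * val (dMono v +ₘ lower v W)
      δ-scalar v = trans (cong (λ k → δ (dMono v +ₘ lower v W) k m) (ℤP.*-comm 1ℤ (ℤ.+ exponent v W)))
                         (δ-* (dMono v +ₘ lower v W) (ℤ.+ exponent v W) 1ℤ m)

module TreeEquality where
  open ℕΣ using (sum-map-∘; sum-map-cong; sum-map-*ˡ; sum-map-*ʳ; ind-∧; sum-map-0) renaming (ind to indℕ)
  open import Relation.Nullary.Decidable using (map′)

  node-injective : ∀ {l l' cs cs'} → node l cs ≡ node l' cs' → l ≡ l' × cs ≡ cs'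
  node-injective refl = refl , refl

  -- Opaque so that `with s ≟ₜ t` finds the decision in goals.
  opaque
    mutual
      _≟ₜ_ : DecidableEquality LTree
      node l cs ≟ₜ node l' cs' =
        map′ (λ { (refl , refl) → refl }) node-injective (l ℕ.≟ l' ×-dec cs ≟F cs')

      _≟F_ : DecidableEquality (List LTree)
      [] ≟F [] = yes refl
      [] ≟F (_ ∷ _) = no λ ()
      (_ ∷ _) ≟F [] = no λ ()
      (t ∷ ts) ≟F (u ∷ us) = map′ (λ { (refl , refl) → refl }) ListP.∷-injective (t ≟ₜ u ×-dec ts ≟F us)

    does-≟ₜ : ∀ l₀ cs l u → does (node l₀ cs ≟ₜ node l u) ≡ (l₀ ≡ᵇ l) ∧ does (cs ≟F u)
    does-≟ₜ l₀ cs l u = refl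

    does-≟F : ∀ t₀ ts t u → does ((t₀ ∷ ts) ≟F (t ∷ u)) ≡ does (t₀ ≟ₜ t) ∧ does (ts ≟F u)
    does-≟F t₀ ts t u = refl

    does-[]≟F : ∀ t u → does ([] ≟F (t ∷ u)) ≡ false
    does-[]≟F t u = refl

  open Multiplicity _≟ₜ_ public
  open Multiplicity _≟F_ public
    using () renaming (mult to multF; mult-++ to multF-++; mult-∉ to multF-∉; mult-concatMap to multF-concatMap)

  mult-map-node : ∀ l₀ cs l F → mult (node l₀ cs) (map (node l) F) ≡ indℕ (l₀ ≡ᵇ l) ℕ.* multF cs F
  mult-map-node l₀ cs l F =
    trans (sum-map-∘ (node l) (λ u → indℕ (does (node l₀ cs ≟ₜ u))) F)
          (trans (sum-map-cong (λ u → trans (cong indℕ (does-≟ₜ l₀ cs l u))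
                                            (ind-∧ (l₀ ≡ᵇ l) (does (cs ≟F u)))) F)
                 (sum-map-*ˡ (indℕ (l₀ ≡ᵇ l)) (λ u → indℕ (does (cs ≟F u))) F))

  multF-map-∷ : ∀ t₀ ts t F → multF (t₀ ∷ ts) (map (t ∷_) F) ≡ indℕ (does (t₀ ≟ₜ t)) ℕ.* multF ts F
  multF-map-∷ t₀ ts t F =
    trans (sum-map-∘ (t ∷_) (λ u → indℕ (does ((t₀ ∷ ts) ≟F u))) F)
          (trans (sum-map-cong (λ u → trans (cong indℕ (does-≟F t₀ ts t u))
                                            (ind-∧ (does (t₀ ≟ₜ t)) (does (ts ≟F u)))) F)
                 (sum-map-*ˡ (indℕ (does (t₀ ≟ₜ t))) (λ u → indℕ (does (ts ≟F u))) F))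

  multF-map-∷ʳ : ∀ s ss ts X → multF (s ∷ ss) (map (_∷ ts) X) ≡ mult s X ℕ.* indℕ (does (ss ≟F ts))
  multF-map-∷ʳ s ss ts X =
    trans (sum-map-∘ (_∷ ts) (λ u → indℕ (does ((s ∷ ss) ≟F u))) X)
          (trans (sum-map-cong (λ u → trans (cong indℕ (does-≟F s ss u ts))
                                            (ind-∧ (does (s ≟ₜ u)) (does (ss ≟F ts)))) X)
                 (sum-map-*ʳ (indℕ (does (ss ≟F ts))) (λ u → indℕ (does (s ≟ₜ u))) X))

  multF-[]-map-∷ : ∀ t X → multF [] (map (t ∷_) X) ≡ 0
  multF-[]-map-∷ t [] = refl
  multF-[]-map-∷ t (u ∷ X) rewrite does-[]≟F t u = multF-[]-map-∷ t X

  multF-[]-map-∷ʳ : ∀ ts X → multF [] (map (_∷ ts) X) ≡ 0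
  multF-[]-map-∷ʳ ts [] = refl
  multF-[]-map-∷ʳ ts (u ∷ X) rewrite does-[]≟F u ts = multF-[]-map-∷ʳ ts X

module Enumeration where
  open Data.Nat using (_+_; _*_)
  open ℕΣ using (sum-map-cong; sum-map-cong∈; sum-map-*ʳ; sum-map-0; sum-upTo-ind-≡ᵇ; ind-∧)
    renaming (sum to sumℕ; ind to indℕ)
  open Trees using (size; sizeF)
  open TreeEquality
  open ≡-Reasoning

  mutual
    below : ℕ → LTree → Bool
    below b (node l cs) = (l <ᵇ b) ∧ belowF b cs

    belowF : ℕ → List LTree → Bool
    belowF b [] = true
    belowF b (t ∷ ts) = below b t ∧ belowF b ts

  ind-reorder : ∀ a b c → indℕ a * indℕ (b ∧ c) ≡ indℕ (b ∧ (a ∧ c))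
  ind-reorder true  true  c = ℕP.+-identityʳ (indℕ c)
  ind-reorder true  false c = refl
  ind-reorder false true  c = refl
  ind-reorder false false c = refl

  ind-reorder₄ : ∀ a b c d → indℕ a * (indℕ b * indℕ (c ∧ d)) ≡ indℕ ((a ∧ c) ∧ (b ∧ d))
  ind-reorder₄ true  true  true  d = trans (ℕP.*-identityˡ _) (ℕP.*-identityˡ (indℕ d))
  ind-reorder₄ true  true  false d = refl
  ind-reorder₄ true  false true  d = refl
  ind-reorder₄ true  false false d = refl
  ind-reorder₄ false b     c     d = refl

  <ᵇ∧≡ᵇ∸ : ∀ p q s → ((p <ᵇ suc s) ∧ (q ≡ᵇ s ∸ p)) ≡ (p + q ≡ᵇ s)
  <ᵇ∧≡ᵇ∸ zero q s = refl
  <ᵇ∧≡ᵇ∸ (suc p) q zero = refl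
  <ᵇ∧≡ᵇ∸ (suc p) q (suc s) = <ᵇ∧≡ᵇ∸ p q s

  fuel-tree : ∀ {f s j} → 2 * suc s ≤ f → j < suc s → 2 * suc j ≤ f
  fuel-tree fuel (s≤s j≤s) = ℕP.≤-trans (ℕP.*-monoʳ-≤ 2 (s≤s j≤s)) fuel

  fuel-forest : ∀ {f s} j → 2 * suc s ≤ f → suc (2 * (s ∸ j)) ≤ f
  fuel-forest {s = s} j fuel = ℕP.≤-trans (s≤s (ℕP.*-monoʳ-≤ 2 (ℕP.m∸n≤m s j)))
    (ℕP.≤-trans (ℕP.≤-trans (ℕP.n≤1+n (suc (2 * s))) (ℕP.≤-reflexive (sym (ℕP.*-suc 2 s)))) fuel)

  fuel-forests : ∀ {f s} → 2 * suc s ≤ suc f → suc (2 * s) ≤ f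
  fuel-forests {s = s} fuel =
    ℕP.≤-pred (ℕP.≤-trans (ℕP.≤-reflexive (cong suc (sym (ℕP.+-suc s (s + 0))))) fuel)

  module _ (b : ℕ) where
    labs : List ℕ
    labs = upTo b

    mutual
      mult-treesF : ∀ f s t → 2 * s ≤ f → mult t (treesF labs f s) ≡ indℕ ((size t ≡ᵇ s) ∧ below b t)
      mult-treesF zero zero (node l cs) _ = refl
      mult-treesF (suc f) zero (node l cs) _ = refl
      mult-treesF (suc f) (suc s) (node l₀ cs) fuel = begin
        mult (node l₀ cs) (concatMap (λ l → map (node l) (forestsF labs f s)) labs)
          ≡⟨ mult-concatMap (node l₀ cs) (λ l → map (node l) (forestsF labs f s)) labs ⟩
        sumℕ (map (λ l → mult (node l₀ cs) (map (node l) (forestsF labs f s))) labs)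
          ≡⟨ sum-map-cong (λ l → mult-map-node l₀ cs l (forestsF labs f s)) labs ⟩
        sumℕ (map (λ l → indℕ (l₀ ≡ᵇ l) * multF cs (forestsF labs f s)) labs)
          ≡⟨ sum-upTo-ind-≡ᵇ b l₀ (λ _ → multF cs (forestsF labs f s)) ⟩
        indℕ (l₀ <ᵇ b) * multF cs (forestsF labs f s)
          ≡⟨ cong (indℕ (l₀ <ᵇ b) *_) (multF-forestsF f s cs (fuel-forests fuel)) ⟩
        indℕ (l₀ <ᵇ b) * indℕ ((sizeF cs ≡ᵇ s) ∧ belowF b cs)
          ≡⟨ ind-reorder (l₀ <ᵇ b) (sizeF cs ≡ᵇ s) (belowF b cs) ⟩
        indℕ ((sizeF cs ≡ᵇ s) ∧ ((l₀ <ᵇ b) ∧ belowF b cs)) ∎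

      multF-forestsF : ∀ f s ts → suc (2 * s) ≤ f →
                       multF ts (forestsF labs f s) ≡ indℕ ((sizeF ts ≡ᵇ s) ∧ belowF b ts)
      multF-forestsF (suc f) zero [] _ rewrite dec-true ([] ≟F []) refl = refl
      multF-forestsF (suc f) zero (t@(node _ _) ∷ ts) _ rewrite dec-false ((t ∷ ts) ≟F []) (λ ()) = refl
      multF-forestsF (suc f) (suc s) [] _ = begin
        multF [] (concatMap G (upTo (suc s)))
          ≡⟨ multF-concatMap [] G (upTo (suc s)) ⟩
        sumℕ (map (λ j → multF [] (G j)) (upTo (suc s)))
          ≡⟨ sum-map-cong (λ j →
               trans (multF-concatMap [] (λ t → map (t ∷_) (forestsF labs f (s ∸ j))) (treesF labs f (suc j)))
                     (trans (sum-map-cong (λ t → multF-[]-map-∷ t (forestsF labs f (s ∸ j))) (treesF labs f (suc j)))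
                            (sum-map-0 (treesF labs f (suc j))))) (upTo (suc s)) ⟩
        sumℕ (map (λ _ → 0) (upTo (suc s)))
          ≡⟨ sum-map-0 (upTo (suc s)) ⟩
        0 ∎
        where
        G : ℕ → List (List LTree)
        G j = concatMap (λ t → map (t ∷_) (forestsF labs f (s ∸ j))) (treesF labs f (suc j))
      multF-forestsF (suc f) (suc s) (t₁@(node _ cs) ∷ ts) (s≤s fuel) = begin
        multF (t₁ ∷ ts) (concatMap G (upTo (suc s)))
          ≡⟨ multF-concatMap (t₁ ∷ ts) G (upTo (suc s)) ⟩
        sumℕ (map (λ j → multF (t₁ ∷ ts) (G j)) (upTo (suc s)))
          ≡⟨ sum-map-cong∈ (upTo (suc s)) split ⟩
        sumℕ (map (λ j → indℕ (P ≡ᵇ j) * R j) (upTo (suc s)))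
          ≡⟨ sum-upTo-ind-≡ᵇ (suc s) P R ⟩
        indℕ (P <ᵇ suc s) * R P
          ≡⟨ ind-reorder₄ (P <ᵇ suc s) (below b t₁) (Q ≡ᵇ s ∸ P) (belowF b ts) ⟩
        indℕ (((P <ᵇ suc s) ∧ (Q ≡ᵇ s ∸ P)) ∧ (below b t₁ ∧ belowF b ts))
          ≡⟨ cong (λ c → indℕ (c ∧ (below b t₁ ∧ belowF b ts))) (<ᵇ∧≡ᵇ∸ P Q s) ⟩
        indℕ ((P + Q ≡ᵇ s) ∧ (below b t₁ ∧ belowF b ts)) ∎
        where
        P = sizeF cs
        Q = sizeF ts
        G : ℕ → List (List LTree)
        G j = concatMap (λ t → map (t ∷_) (forestsF labs f (s ∸ j))) (treesF labs f (suc j))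
        R : ℕ → ℕ
        R j = indℕ (below b t₁) * indℕ ((Q ≡ᵇ s ∸ j) ∧ belowF b ts)
        split : ∀ j → j ∈ upTo (suc s) → multF (t₁ ∷ ts) (G j) ≡ indℕ (P ≡ᵇ j) * R j
        split j j∈ = begin
          multF (t₁ ∷ ts) (G j)
            ≡⟨ multF-concatMap (t₁ ∷ ts) (λ t → map (t ∷_) (forestsF labs f (s ∸ j))) (treesF labs f (suc j)) ⟩
          sumℕ (map (λ t → multF (t₁ ∷ ts) (map (t ∷_) (forestsF labs f (s ∸ j)))) (treesF labs f (suc j)))
            ≡⟨ sum-map-cong (λ t → multF-map-∷ t₁ ts t (forestsF labs f (s ∸ j))) (treesF labs f (suc j)) ⟩
          sumℕ (map (λ t → indℕ (does (t₁ ≟ₜ t)) * multF ts (forestsF labs f (s ∸ j))) (treesF labs f (suc j)))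
            ≡⟨ sum-map-*ʳ (multF ts (forestsF labs f (s ∸ j))) (λ t → indℕ (does (t₁ ≟ₜ t)))
                          (treesF labs f (suc j)) ⟩
          mult t₁ (treesF labs f (suc j)) * multF ts (forestsF labs f (s ∸ j))
            ≡⟨ cong₂ _*_ (mult-treesF f (suc j) t₁ (fuel-tree fuel (∈P.∈-upTo⁻ j∈)))
                         (multF-forestsF f (s ∸ j) ts (fuel-forest j fuel)) ⟩
          indℕ ((P ≡ᵇ j) ∧ below b t₁) * indℕ ((Q ≡ᵇ s ∸ j) ∧ belowF b ts)
            ≡⟨ cong (_* indℕ ((Q ≡ᵇ s ∸ j) ∧ belowF b ts)) (ind-∧ (P ≡ᵇ j) (below b t₁)) ⟩
          indℕ (P ≡ᵇ j) * indℕ (below b t₁) * indℕ ((Q ≡ᵇ s ∸ j) ∧ belowF b ts)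
            ≡⟨ ℕP.*-assoc (indℕ (P ≡ᵇ j)) (indℕ (below b t₁)) _ ⟩
          indℕ (P ≡ᵇ j) * R j ∎

module IncreasingTrees where
  open import Data.List.Relation.Unary.Linked as Linked using (Linked; []; [-]; _∷_)
  open Reflection
  open Trees

  data Increasing : LTree → Set where
    node : ∀ {l cs} → All (λ t → l < label t) cs → Linked _<_ (map label cs) → All Increasing cs →
           Increasing (node l cs)

  linkedᵇ : List ℕ → Bool
  linkedᵇ [] = true
  linkedᵇ (a ∷ []) = true
  linkedᵇ (a ∷ b ∷ r) = ⌊ a ℕ.<? b ⌋ ∧ linkedᵇ (b ∷ r)

  -- Defs tests for strictly increasing children with a private function; these equations pin it down.
  linkedᵇ-unique : {f : List ℕ → Bool} → f [] ≡ true → (∀ a → f (a ∷ []) ≡ true) →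
                   (∀ a b r → f (a ∷ b ∷ r) ≡ (⌊ a ℕ.<? b ⌋ ∧ f (b ∷ r))) → ∀ xs → f xs ≡ linkedᵇ xs
  linkedᵇ-unique f[] f[-] f∷ [] = f[]
  linkedᵇ-unique f[] f[-] f∷ (a ∷ []) = f[-] a
  linkedᵇ-unique {f} f[] f[-] f∷ (a ∷ b ∷ r) =
    trans (f∷ a b r) (cong (⌊ a ℕ.<? b ⌋ ∧_) (linkedᵇ-unique {f} f[] f[-] f∷ (b ∷ r)))

  increasing-node : ∀ l ts →
    increasing (node l ts) ≡ (allB (λ t → ⌊ l ℕ.<? label t ⌋) ts ∧ (linkedᵇ (map label ts) ∧ increasingF ts))
  increasing-node l ts with map label ts | linkedᵇ-unique refl (λ _ → refl) (λ _ _ _ → refl)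
  ... | labels | f≡linkedᵇ =
    cong (λ b → allB (λ t → ⌊ l ℕ.<? label t ⌋) ts ∧ (b ∧ increasingF ts)) (f≡linkedᵇ labels)

  linkedᵇ⇒Linked : ∀ xs → linkedᵇ xs ≡ true → Linked _<_ xs
  linkedᵇ⇒Linked [] _ = []
  linkedᵇ⇒Linked (a ∷ []) _ = [-]
  linkedᵇ⇒Linked (a ∷ b ∷ r) e =
    ⌊⌋-sound (a ℕ.<? b) (∧-conicalˡ _ _ e) ∷ linkedᵇ⇒Linked (b ∷ r) (∧-conicalʳ ⌊ a ℕ.<? b ⌋ _ e)

  Linked⇒linkedᵇ : ∀ {xs} → Linked _<_ xs → linkedᵇ xs ≡ true
  Linked⇒linkedᵇ [] = refl
  Linked⇒linkedᵇ [-] = refl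
  Linked⇒linkedᵇ (a<b ∷ rest) = ∧-intro (⌊⌋-complete (_ ℕ.<? _) a<b) (Linked⇒linkedᵇ rest)

  mutual
    increasing⇒ : ∀ t → increasing t ≡ true → Increasing t
    increasing⇒ (node l ts) e
      with ∧-true {allB (λ t → ⌊ l ℕ.<? label t ⌋) ts} (trans (sym (increasing-node l ts)) e)
    ... | e₁ , e₂ with ∧-true {linkedᵇ (map label ts)} e₂
    ... | e₃ , e₄ = node (allB⇒All _ (λ t → ⌊⌋-sound (l ℕ.<? label t)) ts e₁)
                         (linkedᵇ⇒Linked (map label ts) e₃) (increasingF⇒ ts e₄)

    increasingF⇒ : ∀ ts → increasingF ts ≡ true → All Increasing ts
    increasingF⇒ [] _ = []
    increasingF⇒ (t ∷ ts) e with ∧-true {increasing t} e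
    ... | e₁ , e₂ = increasing⇒ t e₁ ∷ increasingF⇒ ts e₂

  mutual
    ⇒increasing : ∀ {t} → Increasing t → increasing t ≡ true
    ⇒increasing {node l ts} (node l<ts linked incs) =
      trans (increasing-node l ts)
            (∧-intro (All⇒allB _ (λ t → ⌊⌋-complete (l ℕ.<? label t)) l<ts)
                     (∧-intro (Linked⇒linkedᵇ linked) (⇒increasingF incs)))

    ⇒increasingF : ∀ {ts} → All Increasing ts → increasingF ts ≡ true
    ⇒increasingF [] = refl
    ⇒increasingF (inc ∷ incs) = ∧-intro (⇒increasing inc) (⇒increasingF incs)

module Characterisation where
  open ℕΣ using (ind-∧) renaming (ind to indℕ)
  open Trees
  open TreeEquality
  open Enumeration
  open IncreasingTrees
  open Reflection

  record IsIncreasingTree (n : ℕ) (t : LTree) : Set where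
    field
      covers : ∀ i → i ≤ n → i ∈ flatten t
      isIncreasing : Increasing t
      size≡ : size t ≡ suc n
      bounded : All (_≤ n) (flatten t)

  -- The filter condition defining 𝒯 n, and the condition under which candidates n lists t.
  good : ℕ → LTree → Bool
  good n t = (surjLabels n t ∧ increasing t) ∧ ((size t ≡ᵇ suc n) ∧ below (suc n) t)

  mult-𝒯 : ∀ n t → mult t (𝒯 n) ≡ indℕ (good n t)
  mult-𝒯 n t = begin
    mult t (𝒯 n)
      ≡⟨ mult-filter (λ u → Data.Bool.T? (surjLabels n u ∧ increasing u)) t (candidates n) ⟩
    indℕ (surjLabels n t ∧ increasing t) ℕ.* mult t (candidates n)
      ≡⟨ cong (indℕ (surjLabels n t ∧ increasing t) ℕ.*_)
              (mult-treesF (suc n) (2 ℕ.* n ℕ.+ 4) (suc n) t enough-fuel) ⟩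
    indℕ (surjLabels n t ∧ increasing t) ℕ.* indℕ ((size t ≡ᵇ suc n) ∧ below (suc n) t)
      ≡⟨ sym (ind-∧ (surjLabels n t ∧ increasing t) _) ⟩
    indℕ (good n t) ∎
    where
    open ≡-Reasoning
    enough-fuel : 2 ℕ.* suc n ≤ 2 ℕ.* n ℕ.+ 4
    enough-fuel = ℕP.≤-trans (ℕP.≤-reflexive (trans (ℕP.*-suc 2 n) (ℕP.+-comm 2 (2 ℕ.* n))))
                             (ℕP.+-monoʳ-≤ (2 ℕ.* n) (s≤s (s≤s z≤n)))

  mutual
    below⇒ : ∀ b t → below b t ≡ true → All (_< b) (flatten t)
    below⇒ b (node l cs) e = <ᵇ-sound l b (∧-conicalˡ _ _ e) ∷ belowF⇒ b cs (∧-conicalʳ (l <ᵇ b) _ e)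

    belowF⇒ : ∀ b ts → belowF b ts ≡ true → All (_< b) (flattenF ts)
    belowF⇒ b [] _ = []
    belowF⇒ b (t ∷ ts) e =
      AllP.++⁺ (below⇒ b t (∧-conicalˡ _ _ e)) (belowF⇒ b ts (∧-conicalʳ (below b t) _ e))

  mutual
    ⇒below : ∀ b t → All (_< b) (flatten t) → below b t ≡ true
    ⇒below b (node l cs) (l<b ∷ rest) = ∧-intro (<ᵇ-true l<b) (⇒belowF b cs rest)

    ⇒belowF : ∀ b ts → All (_< b) (flattenF ts) → belowF b ts ≡ true
    ⇒belowF b [] _ = refl
    ⇒belowF b (t ∷ ts) all =
      ∧-intro (⇒below b t (AllP.++⁻ˡ (flatten t) all)) (⇒belowF b ts (AllP.++⁻ʳ (flatten t) all))

  surjLabels⇒ : ∀ n t → surjLabels n t ≡ true → ∀ i → i ≤ n → i ∈ flatten t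
  surjLabels⇒ n t e i i≤n = subst (i ∈_) (labels≡flatten t)
    (All.lookup (allB⇒All _ (λ j → anyB⇒Any (j ℕ.≟_) (labels t)) (upTo (suc n)) e) (∈P.∈-upTo⁺ (s≤s i≤n)))

  ⇒surjLabels : ∀ n t → (∀ i → i ≤ n → i ∈ flatten t) → surjLabels n t ≡ true
  ⇒surjLabels n t covers = All⇒allB _ (λ i i∈ → Any⇒anyB (i ℕ.≟_) i∈)
    (All.tabulate (λ {i} i∈upTo →
      subst (i ∈_) (sym (labels≡flatten t)) (covers i (ℕP.≤-pred (∈P.∈-upTo⁻ i∈upTo)))))

  good⇒ : ∀ n t → good n t ≡ true → IsIncreasingTree n t
  good⇒ n t e with ∧-true {surjLabels n t ∧ increasing t} e
  ... | e₁ , e₂ with ∧-true {surjLabels n t} e₁ | ∧-true {size t ≡ᵇ suc n} e₂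
  ... | surj , inc | size≡ , bnd = record
    { covers = surjLabels⇒ n t surj
    ; isIncreasing = increasing⇒ t inc
    ; size≡ = ≡ᵇ-sound (size t) (suc n) size≡
    ; bounded = All.map ℕP.≤-pred (below⇒ (suc n) t bnd)
    }

  ⇒good : ∀ {n t} → IsIncreasingTree n t → good n t ≡ true
  ⇒good {n} {t} T =
    ∧-intro (∧-intro (⇒surjLabels n t covers) (⇒increasing isIncreasing))
            (∧-intro (trans (cong (_≡ᵇ suc n) size≡) (≡ᵇ-refl (suc n))) (⇒below (suc n) t (All.map s≤s bounded)))
    where open IsIncreasingTree T

  ∈𝒯⇒good : ∀ k {T} → T ∈ 𝒯 k → IsIncreasingTree k T
  ∈𝒯⇒good k {T} T∈ = good⇒ k T (ind≥1 (ℕP.≤-trans (mult-∈ T∈) (ℕP.≤-reflexive (mult-𝒯 k T))))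
    where
    ind≥1 : ∀ {b} → 1 ≤ indℕ b → b ≡ true
    ind≥1 {true} _ = refl

module Growth (N : ℕ) where
  open Data.Nat using (_+_)
  open ℕΣ using () renaming (ind to indℕ)
  open import Data.List.Relation.Unary.Linked as Linked using (Linked; []; [-]; _∷_)
  open Trees
  open Occurrences
  open Insertion
  open IncreasingTrees
  open TreeEquality

  leaf : LTree
  leaf = node N []

  mutual
    data Grows : LTree → LTree → Set where
      atRoot : ∀ {l cs} → Grows (node l cs) (node l (cs ++ leaf ∷ []))
      inside : ∀ {l cs cs'} → GrowsF cs cs' → Grows (node l cs) (node l cs')

    data GrowsF : List LTree → List LTree → Set where
      inHead : ∀ {t t' ts} → Grows t t' → GrowsF (t ∷ ts) (t' ∷ ts)
      inTail : ∀ {t ts ts'} → GrowsF ts ts' → GrowsF (t ∷ ts) (t ∷ ts')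

  mutual
    ∈addLeaf⇒Grows : ∀ T {s} → s ∈ addLeaf N T → Grows T s
    ∈addLeaf⇒Grows (node l cs) (here refl) = atRoot
    ∈addLeaf⇒Grows (node l cs) (there s∈) with ∈P.∈-map⁻ (node l) s∈
    ... | cs' , cs'∈ , refl = inside (∈addLeafF⇒GrowsF cs cs'∈)

    ∈addLeafF⇒GrowsF : ∀ ts {ss} → ss ∈ addLeafF N ts → GrowsF ts ss
    ∈addLeafF⇒GrowsF (t ∷ ts) ss∈ with ∈P.∈-++⁻ (map (_∷ ts) (addLeaf N t)) ss∈
    ... | inj₁ ∈head with ∈P.∈-map⁻ (_∷ ts) ∈head
    ...   | t' , t'∈ , refl = inHead (∈addLeaf⇒Grows t t'∈)
    ∈addLeafF⇒GrowsF (t ∷ ts) ss∈ | inj₂ ∈tail with ∈P.∈-map⁻ (t ∷_) ∈tail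
    ...   | ts' , ts'∈ , refl = inTail (∈addLeafF⇒GrowsF ts ts'∈)

  mutual
    Grows⇒∈addLeaf : ∀ {T s} → Grows T s → s ∈ addLeaf N T
    Grows⇒∈addLeaf atRoot = here refl
    Grows⇒∈addLeaf (inside g) = there (∈P.∈-map⁺ (node _) (GrowsF⇒∈addLeafF g))

    GrowsF⇒∈addLeafF : ∀ {ts ss} → GrowsF ts ss → ss ∈ addLeafF N ts
    GrowsF⇒∈addLeafF {t ∷ ts} (inHead g) = ∈P.∈-++⁺ˡ (∈P.∈-map⁺ (_∷ ts) (Grows⇒∈addLeaf g))
    GrowsF⇒∈addLeafF {t ∷ ts} (inTail g) =
      ∈P.∈-++⁺ʳ (map (_∷ ts) (addLeaf N t)) (∈P.∈-map⁺ (t ∷_) (GrowsF⇒∈addLeafF g))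

  mutual
    grows-size : ∀ {T s} → Grows T s → size s ≡ suc (size T)
    grows-size {node l cs} atRoot = cong suc (trans (sizeF-++ cs (leaf ∷ [])) (ℕP.+-comm (sizeF cs) 1))
    grows-size (inside g) = cong suc (growsF-size g)

    growsF-size : ∀ {ts ss} → GrowsF ts ss → sizeF ss ≡ suc (sizeF ts)
    growsF-size {t ∷ ts} (inHead g) = cong (_+ sizeF ts) (grows-size g)
    growsF-size {t ∷ ts} (inTail g) = trans (cong (size t +_) (growsF-size g)) (ℕP.+-suc (size t) (sizeF ts))

  mutual
    grows-occ : ∀ i {T s} → Grows T s → occ i (flatten s) ≡ occ i (flatten T) + indℕ (i ≡ᵇ N)
    grows-occ i {node l cs} atRoot = begin
      indℕ (i ≡ᵇ l) + occ i (flattenF (cs ++ leaf ∷ []))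
        ≡⟨ cong (λ xs → indℕ (i ≡ᵇ l) + occ i xs) (flattenF-++ cs (leaf ∷ [])) ⟩
      indℕ (i ≡ᵇ l) + occ i (flattenF cs ++ N ∷ [])
        ≡⟨ cong (indℕ (i ≡ᵇ l) +_) (occ-++ i (flattenF cs) (N ∷ [])) ⟩
      indℕ (i ≡ᵇ l) + (occ i (flattenF cs) + (indℕ (i ≡ᵇ N) + 0))
        ≡⟨ cong (λ k → indℕ (i ≡ᵇ l) + (occ i (flattenF cs) + k)) (ℕP.+-identityʳ _) ⟩
      indℕ (i ≡ᵇ l) + (occ i (flattenF cs) + indℕ (i ≡ᵇ N))
        ≡⟨ sym (ℕP.+-assoc (indℕ (i ≡ᵇ l)) _ _) ⟩
      indℕ (i ≡ᵇ l) + occ i (flattenF cs) + indℕ (i ≡ᵇ N) ∎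
      where open ≡-Reasoning
    grows-occ i {node l cs} (inside g) =
      trans (cong (indℕ (i ≡ᵇ l) +_) (growsF-occ i g)) (sym (ℕP.+-assoc (indℕ (i ≡ᵇ l)) _ _))

    growsF-occ : ∀ i {ts ss} → GrowsF ts ss → occ i (flattenF ss) ≡ occ i (flattenF ts) + indℕ (i ≡ᵇ N)
    growsF-occ i {t ∷ ts} {t' ∷ _} (inHead g) = begin
      occ i (flatten t' ++ flattenF ts)
        ≡⟨ occ-++ i (flatten t') (flattenF ts) ⟩
      occ i (flatten t') + occ i (flattenF ts)
        ≡⟨ cong (_+ occ i (flattenF ts)) (grows-occ i g) ⟩
      occ i (flatten t) + indℕ (i ≡ᵇ N) + occ i (flattenF ts)
        ≡⟨ ℕP.+-assoc (occ i (flatten t)) _ _ ⟩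
      occ i (flatten t) + (indℕ (i ≡ᵇ N) + occ i (flattenF ts))
        ≡⟨ cong (occ i (flatten t) +_) (ℕP.+-comm _ (occ i (flattenF ts))) ⟩
      occ i (flatten t) + (occ i (flattenF ts) + indℕ (i ≡ᵇ N))
        ≡⟨ sym (ℕP.+-assoc (occ i (flatten t)) _ _) ⟩
      occ i (flatten t) + occ i (flattenF ts) + indℕ (i ≡ᵇ N)
        ≡⟨ cong (_+ indℕ (i ≡ᵇ N)) (sym (occ-++ i (flatten t) (flattenF ts))) ⟩
      occ i (flatten t ++ flattenF ts) + indℕ (i ≡ᵇ N) ∎
      where open ≡-Reasoning
    growsF-occ i {t ∷ ts} {_ ∷ ts'} (inTail g) = begin
      occ i (flatten t ++ flattenF ts')
        ≡⟨ occ-++ i (flatten t) (flattenF ts') ⟩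
      occ i (flatten t) + occ i (flattenF ts')
        ≡⟨ cong (occ i (flatten t) +_) (growsF-occ i g) ⟩
      occ i (flatten t) + (occ i (flattenF ts) + indℕ (i ≡ᵇ N))
        ≡⟨ sym (ℕP.+-assoc (occ i (flatten t)) _ _) ⟩
      occ i (flatten t) + occ i (flattenF ts) + indℕ (i ≡ᵇ N)
        ≡⟨ cong (_+ indℕ (i ≡ᵇ N)) (sym (occ-++ i (flatten t) (flattenF ts))) ⟩
      occ i (flatten t ++ flattenF ts) + indℕ (i ≡ᵇ N) ∎
      where open ≡-Reasoning

  grows-∈ : ∀ {T s i} → Grows T s → i ∈ flatten T → i ∈ flatten s
  grows-∈ {T} {s} {i} g i∈T =
    occ-∈⁻ (flatten s)
      (ℕP.≤-trans (occ-∈ i∈T) (ℕP.≤-trans (ℕP.m≤m+n _ _) (ℕP.≤-reflexive (sym (grows-occ i g)))))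

  grows-∈⁻ : ∀ {T s i} → Grows T s → i ∈ flatten s → i ≢ N → i ∈ flatten T
  grows-∈⁻ {T} {s} {i} g i∈s i≢N = occ-∈⁻ (flatten T) (ℕP.≤-trans (occ-∈ i∈s) (ℕP.≤-reflexive (begin
    occ i (flatten s)                         ≡⟨ grows-occ i g ⟩
    occ i (flatten T) + indℕ (i ≡ᵇ N)         ≡⟨ cong (λ b → occ i (flatten T) + indℕ b) (≡ᵇ-false i N i≢N) ⟩
    occ i (flatten T) + 0                     ≡⟨ ℕP.+-identityʳ _ ⟩
    occ i (flatten T)                         ∎)))
    where open ≡-Reasoning

  grows-∋N : ∀ {T s} → Grows T s → N ∈ flatten s
  grows-∋N {T} {s} g = occ-∈⁻ (flatten s) (subst (1 ≤_) (sym (grows-occ N g))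
    (ℕP.≤-trans (ℕP.≤-reflexive (cong indℕ (sym (≡ᵇ-refl N)))) (ℕP.m≤n+m _ (occ N (flatten T)))))

  growsF-labels : ∀ {ts ss} → GrowsF ts ss → map label ss ≡ map label ts
  growsF-labels (inHead atRoot) = refl
  growsF-labels (inHead (inside _)) = refl
  growsF-labels (inTail g) = cong (_ ∷_) (growsF-labels g)

  linked-∷ʳ : ∀ {xs v} → Linked _<_ xs → All (_< v) xs → Linked _<_ (xs ++ v ∷ [])
  linked-∷ʳ [] [] = [-]
  linked-∷ʳ [-] (a<v ∷ []) = a<v ∷ [-]
  linked-∷ʳ (a<b ∷ rest) (_ ∷ bs<v) = a<b ∷ linked-∷ʳ rest bs<v

  linked-∷ʳ⁻ : ∀ xs {v} → Linked _<_ (xs ++ v ∷ []) → Linked _<_ xs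
  linked-∷ʳ⁻ [] _ = []
  linked-∷ʳ⁻ (a ∷ []) _ = [-]
  linked-∷ʳ⁻ (a ∷ b ∷ xs) (a<b ∷ rest) = a<b ∷ linked-∷ʳ⁻ (b ∷ xs) rest

  childLabels : ∀ {P : ℕ → Set} cs → All P (flattenF cs) → All P (map label cs)
  childLabels [] _ = []
  childLabels (node l c ∷ cs) (Pl ∷ Prest) = Pl ∷ childLabels cs (AllP.++⁻ʳ (flattenF c) Prest)

  relabel : ∀ {l cs cs'} → map label cs' ≡ map label cs →
            All (λ t → l < label t) cs → All (λ t → l < label t) cs'
  relabel {l} eq l<cs = AllP.map⁻ (subst (All (l <_)) (sym eq) (AllP.map⁺ l<cs))

  mutual
    grows-increasing : ∀ {T s} → Grows T s → Increasing T → All (_< N) (flatten T) → Increasing s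
    grows-increasing {node l cs} atRoot (node l<cs linked incs) (l<N ∷ below) =
      node (AllP.++⁺ l<cs (l<N ∷ []))
           (subst (Linked _<_) (sym (ListP.map-++ label cs (leaf ∷ []))) (linked-∷ʳ linked (childLabels cs below)))
           (AllP.++⁺ incs (node [] [] [] ∷ []))
    grows-increasing (inside g) (node l<cs linked incs) (_ ∷ below) =
      node (relabel (growsF-labels g) l<cs) (subst (Linked _<_) (sym (growsF-labels g)) linked)
           (growsF-increasing g incs below)

    growsF-increasing : ∀ {ts ss} → GrowsF ts ss → All Increasing ts → All (_< N) (flattenF ts) → All Increasing ss
    growsF-increasing {t ∷ _} (inHead g) (inc ∷ incs) below =
      grows-increasing g inc (AllP.++⁻ˡ (flatten t) below) ∷ incs
    growsF-increasing {t ∷ _} (inTail g) (inc ∷ incs) below =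
      inc ∷ growsF-increasing g incs (AllP.++⁻ʳ (flatten t) below)

  mutual
    grows-increasing⁻ : ∀ {T s} → Grows T s → Increasing s → Increasing T
    grows-increasing⁻ {node l cs} atRoot (node l<cs' linked' incs') =
      node (AllP.++⁻ˡ cs l<cs')
           (linked-∷ʳ⁻ (map label cs) (subst (Linked _<_) (ListP.map-++ label cs (leaf ∷ [])) linked'))
           (AllP.++⁻ˡ cs incs')
    grows-increasing⁻ (inside g) (node l<cs' linked' incs') =
      node (relabel (sym (growsF-labels g)) l<cs') (subst (Linked _<_) (growsF-labels g) linked')
           (growsF-increasing⁻ g incs')

    growsF-increasing⁻ : ∀ {ts ss} → GrowsF ts ss → All Increasing ss → All Increasing ts
    growsF-increasing⁻ (inHead g) (inc ∷ incs) = grows-increasing⁻ g inc ∷ incs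
    growsF-increasing⁻ (inTail g) (inc ∷ incs) = inc ∷ growsF-increasing⁻ g incs

  mutual
    increasing-root-min : ∀ {t} → Increasing t → All (label t ≤_) (flatten t)
    increasing-root-min (node l<cs _ incs) = ℕP.≤-refl ∷ All.map ℕP.<⇒≤ (forest-above l<cs incs)

    forest-above : ∀ {l ts} → All (λ t → l < label t) ts → All Increasing ts → All (l <_) (flattenF ts)
    forest-above [] [] = []
    forest-above (l<t ∷ l<ts) (inc ∷ incs) =
      AllP.++⁺ (All.map (ℕP.<-≤-trans l<t) (increasing-root-min inc)) (forest-above l<ts incs)

  mutual
    prune : LTree → LTree
    prune (node l cs) = node l (pruneF cs)

    pruneF : List LTree → List LTree
    pruneF [] = []
    pruneF (node l cs ∷ ts) = if l ≡ᵇ N then pruneF ts else node l (pruneF cs) ∷ pruneF ts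

  fresh-node : ∀ {l cs} → occ N (flatten (node l cs)) ≡ 0 → (l ≡ᵇ N) ≡ false × occ N (flattenF cs) ≡ 0
  fresh-node {l} {cs} fresh =
    trans (≡ᵇ-sym l N) (ind≡0 (ℕP.m+n≡0⇒m≡0 _ fresh)) , ℕP.m+n≡0⇒n≡0 (indℕ (N ≡ᵇ l)) fresh
    where
    ind≡0 : ∀ {b} → indℕ b ≡ 0 → b ≡ false
    ind≡0 {false} _ = refl

  fresh-++ : ∀ xs ys → occ N (xs ++ ys) ≡ 0 → occ N xs ≡ 0 × occ N ys ≡ 0
  fresh-++ xs ys fresh = ℕP.m+n≡0⇒m≡0 _ fresh′ , ℕP.m+n≡0⇒n≡0 (occ N xs) fresh′
    where
    fresh′ : occ N xs + occ N ys ≡ 0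
    fresh′ = trans (sym (occ-++ N xs ys)) fresh

  mutual
    prune-fresh : ∀ T → occ N (flatten T) ≡ 0 → prune T ≡ T
    prune-fresh (node l cs) fresh = cong (node l) (pruneF-fresh cs (proj₂ (fresh-node {l} {cs} fresh)))

    pruneF-fresh : ∀ ts → occ N (flattenF ts) ≡ 0 → pruneF ts ≡ ts
    pruneF-fresh [] _ = refl
    pruneF-fresh (node l cs ∷ ts) fresh with fresh-++ (flatten (node l cs)) (flattenF ts) fresh
    ... | fresh-t , fresh-ts with fresh-node {l} {cs} fresh-t
    ...   | l≢N , fresh-cs rewrite l≢N =
      cong₂ _∷_ (cong (node l) (pruneF-fresh cs fresh-cs)) (pruneF-fresh ts fresh-ts)

  label-fresh : ∀ t → occ N (flatten t) ≡ 0 → (label t ≡ᵇ N) ≡ false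
  label-fresh (node l cs) fresh = proj₁ (fresh-node {l} {cs} fresh)

  grows-label : ∀ {T s} → Grows T s → label s ≡ label T
  grows-label atRoot = refl
  grows-label (inside _) = refl

  pruneF-∷ : ∀ t ts → (label t ≡ᵇ N) ≡ false → pruneF (t ∷ ts) ≡ prune t ∷ pruneF ts
  pruneF-∷ (node l cs) ts l≢N rewrite l≢N = refl

  pruneF-++ : ∀ ts us → pruneF (ts ++ us) ≡ pruneF ts ++ pruneF us
  pruneF-++ [] us = refl
  pruneF-++ (node l cs ∷ ts) us with l ≡ᵇ N
  ... | true = pruneF-++ ts us
  ... | false = cong (node l (pruneF cs) ∷_) (pruneF-++ ts us)

  pruneF-leaf : pruneF (leaf ∷ []) ≡ []
  pruneF-leaf rewrite ≡ᵇ-refl N = refl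

  mutual
    prune-grows : ∀ {T s} → occ N (flatten T) ≡ 0 → Grows T s → prune s ≡ T
    prune-grows {node l cs} fresh atRoot = cong (node l) (begin
      pruneF (cs ++ leaf ∷ [])
        ≡⟨ pruneF-++ cs (leaf ∷ []) ⟩
      pruneF cs ++ pruneF (leaf ∷ [])
        ≡⟨ cong₂ _++_ (pruneF-fresh cs (proj₂ (fresh-node {l} {cs} fresh))) pruneF-leaf ⟩
      cs ++ []
        ≡⟨ ListP.++-identityʳ cs ⟩
      cs                                    ∎)
      where open ≡-Reasoning
    prune-grows {node l cs} fresh (inside g) = cong (node l) (pruneF-grows (proj₂ (fresh-node {l} {cs} fresh)) g)

    pruneF-grows : ∀ {ts ss} → occ N (flattenF ts) ≡ 0 → GrowsF ts ss → pruneF ss ≡ ts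
    pruneF-grows {t ∷ ts} fresh (inHead {t' = t'} g) with fresh-++ (flatten t) (flattenF ts) fresh
    ... | fresh-t , fresh-ts =
      trans (pruneF-∷ t' ts (trans (cong (_≡ᵇ N) (grows-label g)) (label-fresh t fresh-t)))
            (cong₂ _∷_ (prune-grows fresh-t g) (pruneF-fresh ts fresh-ts))
    pruneF-grows {t ∷ ts} fresh (inTail g) with fresh-++ (flatten t) (flattenF ts) fresh
    ... | fresh-t , fresh-ts =
      trans (pruneF-∷ t _ (label-fresh t fresh-t)) (cong₂ _∷_ (prune-fresh t fresh-t) (pruneF-grows fresh-ts g))

  +≡1 : ∀ a b → a + b ≡ 1 → (a ≡ 1 × b ≡ 0) ⊎ (a ≡ 0 × b ≡ 1)
  +≡1 zero b e = inj₂ (refl , e)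
  +≡1 (suc zero) zero _ = inj₁ (refl , refl)

  childless : ∀ {cs} → Increasing (node N cs) → All (_≤ N) (flattenF cs) → cs ≡ []
  childless {[]} _ _ = refl
  childless {node l _ ∷ _} (node (N<l ∷ _) _ _) (l≤N ∷ _) =
    contradiction (ℕP.<-≤-trans N<l l≤N) (ℕP.<-irrefl refl)

  last-sibling : ∀ {ts} → Linked _<_ (N ∷ map label ts) → All (_≤ N) (flattenF ts) → ts ≡ []
  last-sibling {[]} _ _ = refl
  last-sibling {node l _ ∷ _} (N<l ∷ _) (l≤N ∷ _) =
    contradiction (ℕP.<-≤-trans N<l l≤N) (ℕP.<-irrefl refl)

  mutual
    prune-grows⁻ : ∀ t → Increasing t → All (_≤ N) (flatten t) → occ N (flatten t) ≡ 1 →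
                   (label t ≡ᵇ N) ≡ false → Grows (prune t) t
    prune-grows⁻ (node l cs) (node _ linked incs) (_ ∷ bound) once l≢N
      with pruneF-grows⁻ cs linked incs bound
             (trans (sym (cong (λ b → indℕ b + occ N (flattenF cs)) (trans (≡ᵇ-sym N l) l≢N))) once)
    ... | inj₁ cs≡ = subst (λ cs' → Grows (node l (pruneF cs)) (node l cs')) (sym cs≡) atRoot
    ... | inj₂ g = inside g

    pruneF-grows⁻ : ∀ ts → Linked _<_ (map label ts) → All Increasing ts → All (_≤ N) (flattenF ts) →
                    occ N (flattenF ts) ≡ 1 → ts ≡ pruneF ts ++ leaf ∷ [] ⊎ GrowsF (pruneF ts) ts
    pruneF-grows⁻ (node l cs ∷ ts) linked (inc ∷ incs) bound once with l ≡ᵇ N in l≡ᵇN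
    ... | true with ≡ᵇ-sound l N l≡ᵇN
    ...   | refl rewrite childless inc (AllP.++⁻ʳ (N ∷ []) (AllP.++⁻ˡ (flatten (node N cs)) bound))
                       | last-sibling linked (AllP.++⁻ʳ (flatten (node N cs)) bound) = inj₁ refl
    pruneF-grows⁻ (node l cs ∷ ts) linked (inc ∷ incs) bound once | false
      with +≡1 (occ N (flatten (node l cs))) (occ N (flattenF ts))
               (trans (sym (occ-++ N (flatten (node l cs)) (flattenF ts))) once)
    ... | inj₁ (once-t , fresh-ts) rewrite pruneF-fresh ts fresh-ts =
      inj₂ (inHead (prune-grows⁻ (node l cs) inc (AllP.++⁻ˡ (flatten (node l cs)) bound) once-t l≡ᵇN))
    ... | inj₂ (fresh-t , once-ts) rewrite pruneF-fresh cs (proj₂ (fresh-node {l} {cs} fresh-t))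
      with pruneF-grows⁻ ts (Linked.tail linked) incs (AllP.++⁻ʳ (flatten (node l cs)) bound) once-ts
    ...   | inj₁ ts≡ = inj₁ (cong (node l cs ∷_) ts≡)
    ...   | inj₂ g = inj₂ (inTail g)

  ind-*-≤ : ∀ b c → indℕ b ℕ.* c ≤ c
  ind-*-≤ true c = ℕP.≤-reflexive (ℕP.+-identityʳ c)
  ind-*-≤ false c = z≤n

  length-grown : ∀ cs → length (cs ++ leaf ∷ []) ≡ suc (length cs)
  length-grown cs = trans (ListP.length-++ cs) (ℕP.+-comm (length cs) 1)

  not-self-grown : ∀ t → mult t (addLeaf N t) ≡ 0
  not-self-grown t = mult-∉ (addLeaf N t) (λ u u∈ t≡u →
    ℕP.1+n≢n (sym (trans (cong size t≡u) (grows-size (∈addLeaf⇒Grows t u∈)))))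

  mutual
    addLeaf-unique : ∀ T s → mult s (addLeaf N T) ≤ 1
    addLeaf-unique (node l cs) s@(node l₀ ss) rewrite mult-map-node l₀ ss l (addLeafF N cs)
      with s ≟ₜ node l (cs ++ leaf ∷ [])
    ... | yes refl =
      ℕP.≤-reflexive (cong suc (trans (cong (indℕ (l ≡ᵇ l) ℕ.*_) not-grown) (ℕP.*-zeroʳ (indℕ (l ≡ᵇ l)))))
      where
      not-grown : multF (cs ++ leaf ∷ []) (addLeafF N cs) ≡ 0
      not-grown = multF-∉ (addLeafF N cs) (λ u u∈ ss≡u →
        ℕP.1+n≢n (trans (sym (length-grown cs)) (trans (cong length ss≡u) (addLeafF-length N cs u u∈))))
    ... | no _ = ℕP.≤-trans (ind-*-≤ (l₀ ≡ᵇ l) _) (addLeafF-unique cs ss)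

    addLeafF-unique : ∀ cs ss → multF ss (addLeafF N cs) ≤ 1
    addLeafF-unique [] ss = z≤n
    addLeafF-unique (t ∷ ts) [] rewrite multF-++ [] (map (_∷ ts) (addLeaf N t)) (map (t ∷_) (addLeafF N ts))
                                      | multF-[]-map-∷ʳ ts (addLeaf N t) | multF-[]-map-∷ t (addLeafF N ts) = z≤n
    addLeafF-unique (t ∷ ts) (s ∷ ss)
      rewrite multF-++ (s ∷ ss) (map (_∷ ts) (addLeaf N t)) (map (t ∷_) (addLeafF N ts))
            | multF-map-∷ʳ s ss ts (addLeaf N t) | multF-map-∷ s ss t (addLeafF N ts)
      with s ≟ₜ t
    ... | yes refl rewrite not-self-grown s = ℕP.≤-trans (ℕP.≤-reflexive (ℕP.+-identityʳ _)) (addLeafF-unique ts ss)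
    ... | no _ = ℕP.≤-trans (ℕP.≤-reflexive (ℕP.+-identityʳ _))
                   (ℕP.≤-trans (ℕP.≤-reflexive (ℕP.*-comm (mult s (addLeaf N t)) _))
                     (ℕP.≤-trans (ind-*-≤ (does (ss ≟F ts)) _) (addLeaf-unique t s)))

module Bijection (n : ℕ) where
  open ℕΣ using (sum-map-cong∈; sum-map-*ˡ; ind-∧) renaming (sum to sumℕ; ind to indℕ)
  open Trees
  open Occurrences
  open Insertion
  open TreeEquality
  open IncreasingTrees
  open Characterisation
  open Growth (suc n)
  open IsIncreasingTree

  N : ℕ
  N = suc n

  grows-good : ∀ {T s} → IsIncreasingTree n T → Grows T s → IsIncreasingTree N s
  grows-good {T} {s} T-good g = record
    { covers = cover
    ; isIncreasing = grows-increasing g (isIncreasing T-good) (All.map s≤s (bounded T-good))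
    ; size≡ = trans (grows-size g) (cong suc (size≡ T-good))
    ; bounded = All.tabulate bound
    }
    where
    cover : ∀ i → i ≤ N → i ∈ flatten s
    cover i i≤N with i ℕ.≟ N
    ... | yes refl = grows-∋N g
    ... | no i≢N = grows-∈ g (covers T-good i (ℕP.≤-pred (ℕP.≤∧≢⇒< i≤N i≢N)))
    bound : ∀ {i} → i ∈ flatten s → i ≤ N
    bound {i} i∈ with i ℕ.≟ N
    ... | yes refl = ℕP.≤-refl
    ... | no i≢N = ℕP.m≤n⇒m≤1+n (All.lookup (bounded T-good) (grows-∈⁻ g i∈ i≢N))

  prune-good : ∀ {s} → IsIncreasingTree N s → Grows (prune s) s × IsIncreasingTree n (prune s)
  prune-good {s} s-good = g , record
    { covers = λ i i≤n → grows-∈⁻ g (covers s-good i (ℕP.m≤n⇒m≤1+n i≤n)) (λ { refl → ℕP.1+n≰n i≤n })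
    ; isIncreasing = grows-increasing⁻ g (isIncreasing s-good)
    ; size≡ = ℕP.suc-injective (trans (sym (grows-size g)) (size≡ s-good))
    ; bounded = All.tabulate bound
    }
    where
    once : occ N (flatten s) ≡ 1
    once = pigeonhole N (flatten s) (trans (sym (size≡length s)) (size≡ s-good)) (covers s-good) (bounded s-good)
    root≡0 : label s ≡ 0
    root≡0 = ℕP.n≤0⇒n≡0 (All.lookup (increasing-root-min (isIncreasing s-good)) (covers s-good 0 z≤n))
    g : Grows (prune s) s
    g = prune-grows⁻ s (isIncreasing s-good) (bounded s-good) once (cong (_≡ᵇ N) root≡0)
    fresh : occ N (flatten (prune s)) ≡ 0
    fresh = ℕP.+-cancelʳ-≡ 1 _ 0 (trans (sym (trans (grows-occ N g) N-counted)) once)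
      where
      N-counted : occ N (flatten (prune s)) ℕ.+ indℕ (N ≡ᵇ N) ≡ occ N (flatten (prune s)) ℕ.+ 1
      N-counted = cong (λ b → occ N (flatten (prune s)) ℕ.+ indℕ b) (≡ᵇ-refl N)
    bound : ∀ {i} → i ∈ flatten (prune s) → i ≤ n
    bound {i} i∈ with i ℕ.≟ N
    ... | yes refl = contradiction i∈ (occ-∉ fresh)
    ... | no i≢N = ℕP.≤-pred (ℕP.≤∧≢⇒< (All.lookup (bounded s-good) (grows-∈ g i∈)) i≢N)

  N-fresh : ∀ {T} → IsIncreasingTree n T → occ N (flatten T) ≡ 0
  N-fresh {T} T-good with occ N (flatten T) in e
  ... | zero = refl
  ... | suc _ = contradiction (All.lookup (bounded T-good) N∈T) ℕP.1+n≰n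
    where
    N∈T : N ∈ flatten T
    N∈T = occ-∈⁻ (flatten T) (ℕP.≤-trans (s≤s z≤n) (ℕP.≤-reflexive (sym e)))

  mult-addLeaf : ∀ T s → IsIncreasingTree n T → mult s (addLeaf N T) ≡ indℕ (good N s ∧ does (prune s ≟ₜ T))
  mult-addLeaf T s T-good with good N s in s-good | prune s ≟ₜ T
  ... | true | yes refl =
    ℕP.≤-antisym (addLeaf-unique T s) (mult-∈ (Grows⇒∈addLeaf (proj₁ (prune-good (good⇒ N s s-good)))))
  ... | true | no prune≢T = mult-∉ (addLeaf N T) (λ u u∈ s≡u →
    prune≢T (trans (cong prune s≡u) (prune-grows (N-fresh T-good) (∈addLeaf⇒Grows T u∈))))
  ... | false | _ = mult-∉ (addLeaf N T) (λ u u∈ s≡u →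
    false≢true (trans (sym s-good) (trans (cong (good N) s≡u) (⇒good (grows-good T-good (∈addLeaf⇒Grows T u∈))))))
    where
    false≢true : false ≢ true
    false≢true ()

  mult-grown-𝒯 : ∀ s → mult s (concatMap (addLeaf N) (𝒯 n)) ≡ mult s (𝒯 N)
  mult-grown-𝒯 s = begin
    mult s (concatMap (addLeaf N) (𝒯 n))
      ≡⟨ mult-concatMap s (addLeaf N) (𝒯 n) ⟩
    sumℕ (map (λ T → mult s (addLeaf N T)) (𝒯 n))
      ≡⟨ sum-map-cong∈ (𝒯 n) (λ T T∈ → trans (mult-addLeaf T s (∈𝒯⇒good n T∈)) (ind-∧ (good N s) _)) ⟩
    sumℕ (map (λ T → indℕ (good N s) ℕ.* indℕ (does (prune s ≟ₜ T))) (𝒯 n))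
      ≡⟨ sum-map-*ˡ (indℕ (good N s)) (λ T → indℕ (does (prune s ≟ₜ T))) (𝒯 n) ⟩
    indℕ (good N s) ℕ.* mult (prune s) (𝒯 n)
      ≡⟨ cong (indℕ (good N s) ℕ.*_) (mult-𝒯 n (prune s)) ⟩
    indℕ (good N s) ℕ.* indℕ (good n (prune s))
      ≡⟨ pruned-good (good N s) refl ⟩
    indℕ (good N s)
      ≡⟨ sym (mult-𝒯 N s) ⟩
    mult s (𝒯 N) ∎
    where
    open ≡-Reasoning
    pruned-good : ∀ b → good N s ≡ b → indℕ b ℕ.* indℕ (good n (prune s)) ≡ indℕ b
    pruned-good true s-good rewrite ⇒good (proj₂ (prune-good (good⇒ N s s-good))) = refl
    pruned-good false _ = refl

module GeneratingFunction where
  open Data.Integer using (_+_; _*_)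
  open ℤΣ
  open Monomials
  open Polynomials
  open Derivation
  open Statistics using (weight)
  open Insertion using (addLeaf)
  open TreeEquality using (_≟ₜ_)
  open ≡-Reasoning

  treeTerms : ℕ → Terms
  treeTerms n = map (λ T → (1ℤ , weight T)) (𝒯 n)

  derive-treeTerms : ∀ n → ⟦ derive (treeTerms n) ⟧ ≗ ⟦ treeTerms (suc n) ⟧
  derive-treeTerms n m = begin
    ⟦ derive (treeTerms n) ⟧ m
      ≡⟨ sum-concatMap derivative (evalTerm m) (treeTerms n) ⟩
    sum (map (λ t → ⟦ derivative t ⟧ m) (treeTerms n))
      ≡⟨ sum-map-∘ (λ T → (1ℤ , weight T)) (λ t → ⟦ derivative t ⟧ m) (𝒯 n) ⟩
    sum (map (λ T → ⟦ derivative (1ℤ , weight T) ⟧ m) (𝒯 n))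
      ≡⟨ sum-map-cong (λ T → sym (W.Σ-addLeaf (suc n) T)) (𝒯 n) ⟩
    sum (map (λ T → sum (map (W.val ∘ weight) (addLeaf (suc n) T))) (𝒯 n))
      ≡⟨ sym (sum-concatMap (addLeaf (suc n)) (W.val ∘ weight) (𝒯 n)) ⟩
    sum (map (W.val ∘ weight) (concatMap (addLeaf (suc n)) (𝒯 n)))
      ≡⟨ Multiplicity.sum-map-mult _≟ₜ_ (W.val ∘ weight) (concatMap (addLeaf (suc n)) (𝒯 n)) (𝒯 (suc n))
                                   (Bijection.mult-grown-𝒯 n) ⟩
    sum (map (W.val ∘ weight) (𝒯 (suc n)))
      ≡⟨ sym (sum-map-∘ (λ T → (1ℤ , weight T)) (evalTerm m) (𝒯 (suc n))) ⟩
    ⟦ treeTerms (suc n) ⟧ m ∎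
    where
    module W = Weights m

  coeff-iterate : ∀ n → coeff (iterate n D (var w)) ≗ ⟦ treeTerms n ⟧
  coeff-iterate zero = coeff≗⟦terms⟧ (var w)
  coeff-iterate (suc n) m = begin
    coeff (D (iterate n D (var w))) m      ≡⟨ coeff-D (iterate n D (var w)) m ⟩
    Dcoeff (coeff (iterate n D (var w))) m ≡⟨ Dcoeff-cong (coeff-iterate n) m ⟩
    Dcoeff ⟦ treeTerms n ⟧ m               ≡⟨ sym (⟦derive⟧ (treeTerms n) m) ⟩
    ⟦ derive (treeTerms n) ⟧ m             ≡⟨ derive-treeTerms n m ⟩
    ⟦ treeTerms (suc n) ⟧ m                ∎

  monomialOf : LTree → Poly
  monomialOf T = (var x ^ ee* T) ⊗ (var y ^ oe* T) ⊗ (var z ^ odd* T)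

  terms-x^ : ∀ e → terms (var x ^ e) ≡ (1ℤ , (0 , e , 0 , 0)) ∷ []
  terms-x^ zero = refl
  terms-x^ (suc e) rewrite terms-x^ e = refl

  terms-y^ : ∀ e → terms (var y ^ e) ≡ (1ℤ , (0 , 0 , e , 0)) ∷ []
  terms-y^ zero = refl
  terms-y^ (suc e) rewrite terms-y^ e = refl

  terms-z^ : ∀ e → terms (var z ^ e) ≡ (1ℤ , (0 , 0 , 0 , e)) ∷ []
  terms-z^ zero = refl
  terms-z^ (suc e) rewrite terms-z^ e = refl

  ⟦terms-monomialOf⟧ : ∀ T m → ⟦ terms (monomialOf T) ⟧ m ≡ δ (0 , ee* T , oe* T , odd* T) 1ℤ m + 0ℤ
  ⟦terms-monomialOf⟧ T m
    rewrite terms-x^ (ee* T) | terms-y^ (oe* T) | terms-z^ (odd* T)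
          | ℕP.+-identityʳ (ee* T) | ℕP.+-identityʳ (ee* T) | ℕP.+-identityʳ (oe* T) = refl

  ⟦terms-Σ-list⟧ : ∀ Ts → ⟦ terms (Σ-list (map monomialOf Ts)) ⟧
                         ≗ ⟦ map (λ T → (1ℤ , (0 , ee* T , oe* T , odd* T))) Ts ⟧
  ⟦terms-Σ-list⟧ [] m = ⟦⟧-0∷ (0 , 0 , 0 , 0) [] m
  ⟦terms-Σ-list⟧ (T ∷ Ts) m =
    trans (⟦⟧-++ (terms (monomialOf T)) (terms (Σ-list (map monomialOf Ts))) m)
          (cong₂ _+_ (trans (⟦terms-monomialOf⟧ T m) (ℤP.+-identityʳ (δ (0 , ee* T , oe* T , odd* T) 1ℤ m)))
                     (⟦terms-Σ-list⟧ Ts m))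

  coeff-generating : ∀ n → coeff (var w ⊗ Σ-list (map monomialOf (𝒯 n))) ≗ ⟦ treeTerms n ⟧
  coeff-generating n m = begin
    coeff (var w ⊗ Σ-list (map monomialOf (𝒯 n))) m
      ≡⟨ coeff≗⟦terms⟧ (var w ⊗ Σ-list (map monomialOf (𝒯 n))) m ⟩
    ⟦ mulTerms (terms (var w)) (terms (Σ-list (map monomialOf (𝒯 n)))) ⟧ m
      ≡⟨ mulTerms-cong {terms (var w)} {terms (var w)} {terms (Σ-list (map monomialOf (𝒯 n)))} {weights}
                       (λ _ → refl) (⟦terms-Σ-list⟧ (𝒯 n)) m ⟩
    ⟦ mulTerm 1ℤ (1 , 0 , 0 , 0) weights ++ [] ⟧ m
      ≡⟨ cong (λ A → ⟦ A ⟧ m) (trans (ListP.++-identityʳ (mulTerm 1ℤ (1 , 0 , 0 , 0) weights))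
                                     (w-times (𝒯 n))) ⟩
    ⟦ treeTerms n ⟧ m ∎
    where
    weights : Terms
    weights = map (λ T → (1ℤ , (0 , ee* T , oe* T , odd* T))) (𝒯 n)
    w-times : ∀ Ts → mulTerm 1ℤ (1 , 0 , 0 , 0) (map (λ T → (1ℤ , (0 , ee* T , oe* T , odd* T))) Ts)
                     ≡ map (λ T → (1ℤ , weight T)) Ts
    w-times [] = refl
    w-times (T ∷ Ts) = cong (_ ∷_) (w-times Ts)

open GeneratingFunction using (coeff-iterate; coeff-generating)

theorem3p3 : (n : ℕ) →
    iterate n D (var w)
      ≈ var w ⊗ Σ-list (map (λ T → (var x ^ ee* T) ⊗ (var y ^ oe* T) ⊗ (var z ^ odd* T)) (𝒯 n))
theorem3p3 n m = trans (coeff-iterate n m) (sym (coeff-generating n m))
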